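{- Let $n,r$ be positive integers with $d=\gcd(r,n)>1$ and $\frac{n}{d}=6v+3$ for an integer $v\ge 0$; let $K_r=2^{2r}-2^r+1$ and let $e$ be the least positive residue of the inverse of $\frac{r}{d}$ modulo $\frac{n}{d}$. Let $x_1=(0,0,1,1,1,0)$, $x_2=(0,0,0,1,1,1)$, $x_4=(1,1,1,0,0,0)$, $x_6=(0,1,1,1,0,0)$. Then $$K_r^{ -1}\equiv\sum_{i=0}^{d-1}\sum_{j=0}^{\frac{n}{d}-1}a_{i,j}2^{i-jr}\pmod{2^n-1},$$ where $(a_{i,j})$ is the $d\times\frac nd$ matrix whose rows $0,\dots,d-2$ all equal a sequence $a_1$ and whose last row $d-1$ equals a sequence $a_2$, given as follows: \begin{enumerate} \item[(a)] If $e=6k+1$ ($k\ge0$ an integer): $a_1=(0,0,\,x_1^{(n/d-e-2)/6},\,x_2^{k},\,0)$ and $a_2=(1,\,x_3,\,x_4^{k})$, where $x_3=(1,0,1,0,\dots,1,0)$ has length $\frac nd-e$. \item[(b)] If $e=6k+5$ ($k\ge0$ an integer): $a_1=(0,1,0,0,0,\,x_4^{(n/d-e-4)/6},\,1,1,0,0,\,x_6^{k})$ and $a_2=(0,\,x_5,\,1,1,\,x_2^{k})$, where $x_5=(0,1,0,1,\dots,0,1)$ has length $\frac nd-e+2$. \end{enumerate} In both cases $\mathrm{wt}(K_r^{ -1})=\frac{n-3d+4}{2}$.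
   Context: $K_r^{ -1}$ denotes the least positive residue of the inverse of $K_r$ modulo $2^n-1$, and $\mathrm{wt}(m)$ is the number of ones in the binary expansion of $m$. Powers $2^{m}$ with arbitrary integer $m$ are understood modulo $2^n-1$ (i.e. $2^m=2^{m\bmod n}$). Tuples containing sequences denote concatenation; $u^{m}$ denotes the concatenation of $m$ copies of $u$ (empty if $m=0$). -}

module Defs where

open import Data.Nat using (ℕ; zero; suc; _+_; _*_; _∸_; _^_; _/_; _%_; _<ᵇ_; ∣_-_∣)
open import Data.Nat.Divisibility using (_∣_)
open import Data.Integer using (ℤ; +_; _-_; _%ℕ_)
open import Data.List using (List; []; _∷_; _++_; map; upTo; applyUpTo)
open import Data.Nat.ListAction using (sum)
open import Data.Bool using (if_then_else_)

infix 4 _≡_[mod_]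
_≡_[mod_] : ℕ → ℕ → ℕ → Set
a ≡ b [mod m ] = m ∣ ∣ a - b ∣

-- 2^m for an integer exponent m, with m understood modulo n (n > 0);
-- the value for n = 0 is irrelevant junk.
pow2 : ℕ → ℤ → ℕ
pow2 zero    m = 1
pow2 (suc k) m = 2 ^ (m %ℕ suc k)

-- Hamming weight: number of ones in the binary expansion (fuel = m suffices)
wtF : ℕ → ℕ → ℕ
wtF zero    m = 0
wtF (suc f) m = m % 2 + wtF f (m / 2)

wt : ℕ → ℕ
wt m = wtF m m

K : ℕ → ℕ
K r = 2 ^ (2 * r) ∸ 2 ^ r + 1

rep : ℕ → List ℕ → List ℕ
rep zero    u = []
rep (suc m) u = u ++ rep m u

nth : List ℕ → ℕ → ℕ
nth []       j       = 0
nth (x ∷ xs) zero    = x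
nth (x ∷ xs) (suc j) = nth xs j

x₁ x₂ x₄ x₆ : List ℕ
x₁ = 0 ∷ 0 ∷ 1 ∷ 1 ∷ 1 ∷ 0 ∷ []
x₂ = 0 ∷ 0 ∷ 0 ∷ 1 ∷ 1 ∷ 1 ∷ []
x₄ = 1 ∷ 1 ∷ 1 ∷ 0 ∷ 0 ∷ 0 ∷ []
x₆ = 0 ∷ 1 ∷ 1 ∷ 1 ∷ 0 ∷ 0 ∷ []

x₃ x₅ : ℕ → List ℕ
x₃ L = applyUpTo (λ i → 1 ∸ i % 2) L
x₅ L = applyUpTo (λ i → i % 2) L

-- Case (a), e = 6k+1, m = n/d
a₁-A a₂-A : (m e k : ℕ) → List ℕ
a₁-A m e k = (0 ∷ 0 ∷ []) ++ rep ((m ∸ e ∸ 2) / 6) x₁ ++ rep k x₂ ++ (0 ∷ [])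
a₂-A m e k = (1 ∷ []) ++ x₃ (m ∸ e) ++ rep k x₄

-- Case (b), e = 6k+5, m = n/d
a₁-B a₂-B : (m e k : ℕ) → List ℕ
a₁-B m e k = (0 ∷ 1 ∷ 0 ∷ 0 ∷ 0 ∷ []) ++ rep ((m ∸ e ∸ 4) / 6) x₄
             ++ (1 ∷ 1 ∷ 0 ∷ 0 ∷ []) ++ rep k x₆
a₂-B m e k = (0 ∷ []) ++ x₅ (m ∸ e + 2) ++ (1 ∷ 1 ∷ []) ++ rep k x₂

Σ< : ℕ → (ℕ → ℕ) → ℕ
Σ< N f = sum (map f (upTo N))

matSum : (n r d m : ℕ) → (row₁ row₂ : List ℕ) → ℕ
matSum n r d m row₁ row₂ =
  Σ< d (λ i → Σ< m (λ j →
    nth (if i <ᵇ d ∸ 1 then row₁ else row₂) j * pow2 n (+ i - + (j * r))))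

module Submission where

-- Write N = 2^n - 1, y = 2^r and z = 2^((n - 1) r), so that y z ≡ 1 (mod N).  As
-- i - j r ≡ i + d σ(j) (mod n), where σ(j) is the least residue of -s j modulo m = n/d and
-- σ permutes 0, …, m - 1, the entries a_{i,j} are exactly the binary digits of the matrix
-- sum S, which gives its weight.  Modulo N, S ≡ (2^(d-1) - 1) A₁(z) + 2^(d-1) A₂(z) for the
-- generating polynomials A₁, A₂ of the two rows.  Since z^m ≡ 1 and 2^d z^e ≡ 1, the claim
-- K S ≡ 1 reduces to a polynomial identity in z, z^(6p), z^(6k) and geometric sums of z^6,
-- checked by the ring solver up to explicit multiples of the relations between them.  When
-- e ≢ ±1 (mod 6) only an inverse is asked for; it exists because (1 + y) K = 1 + y³ and y³
-- has odd order, m being odd.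

import Algebra.Properties.Semiring.Sum
import Data.Integer.Properties
import Data.Nat
import Data.Nat.Properties
open import Defs using (_≡_[mod_])

module Σℕ = Algebra.Properties.Semiring.Sum Data.Nat.Properties.+-*-semiring
module Σℤ = Algebra.Properties.Semiring.Sum Data.Integer.Properties.+-*-semiring

module IntegersModulo (N : Data.Nat.ℕ) where

  open import Algebra.Bundles using (CommutativeRing)
  open import Algebra.Structures using (IsCommutativeRing)
  open import Data.Integer using (ℤ; +_; _+_; _*_; -_; _-_; _^_; ∣_∣; _%ℕ_; _/ℕ_)
  import Data.Integer.Properties as ℤ
  open import Data.Integer.DivMod using (a≡a%ℕn+[a/ℕn]*n)
  open import Data.Integer.Tactic.RingSolver using (solve-∀)
  open import Data.Nat as ℕ using (ℕ; _<_)
  import Data.Nat.Properties as ℕ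
  open import Data.Nat.Divisibility using (_∣_; divides; >⇒∤)
  open import Data.Product using (_,_)
  open import Data.Sum using (_⊎_; inj₁; inj₂)
  open import Relation.Binary.PropositionalEquality
  import Relation.Binary.Reasoning.Setoid as SetoidReasoning
  open import Relation.Nullary using (contradiction)

  infix 4 _≈_
  infixr 4 _,_
  record _≈_ (a b : ℤ) : Set where
    constructor _,_
    field
      quotient : ℤ
      difference : a - b ≡ quotient * + N

  ≡⇒≈ : ∀ {a b} → a ≡ b → a ≈ b
  ≡⇒≈ {a} refl = + 0 , ℤ.+-inverseʳ a

  ≈-refl : ∀ {a} → a ≈ a
  ≈-refl = ≡⇒≈ refl

  -‿cong : ∀ {a b} → a ≈ b → - a ≈ - b
  -‿cong {a} {b} (q , eq) = - q , (begin
    - a - - b    ≡⟨ negate a b ⟩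
    - (a - b)    ≡⟨ cong -_ eq ⟩
    - (q * + N)  ≡⟨ ℤ.neg-distribˡ-* q (+ N) ⟩
    - q * + N    ∎)
    where open ≡-Reasoning
          negate : ∀ a b → - a - - b ≡ - (a - b)
          negate = solve-∀

  ≈-sym : ∀ {a b} → a ≈ b → b ≈ a
  ≈-sym {a} {b} (q , eq) = - q , (begin
    b - a        ≡⟨ flip a b ⟩
    - (a - b)    ≡⟨ cong -_ eq ⟩
    - (q * + N)  ≡⟨ ℤ.neg-distribˡ-* q (+ N) ⟩
    - q * + N    ∎)
    where open ≡-Reasoning
          flip : ∀ a b → b - a ≡ - (a - b)
          flip = solve-∀

  ≈-trans : ∀ {a b c} → a ≈ b → b ≈ c → a ≈ c
  ≈-trans {a} {b} {c} (q , eq) (q′ , eq′) = q + q′ , (begin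
    a - c               ≡⟨ split a b c ⟩
    (a - b) + (b - c)   ≡⟨ cong₂ _+_ eq eq′ ⟩
    q * + N + q′ * + N  ≡⟨ ℤ.*-distribʳ-+ (+ N) q q′ ⟨
    (q + q′) * + N      ∎)
    where open ≡-Reasoning
          split : ∀ a b c → a - c ≡ (a - b) + (b - c)
          split = solve-∀

  +-cong : ∀ {a b c d} → a ≈ b → c ≈ d → a + c ≈ b + d
  +-cong {a} {b} {c} {d} (q , eq) (q′ , eq′) = q + q′ , (begin
    (a + c) - (b + d)   ≡⟨ split a b c d ⟩
    (a - b) + (c - d)   ≡⟨ cong₂ _+_ eq eq′ ⟩
    q * + N + q′ * + N  ≡⟨ ℤ.*-distribʳ-+ (+ N) q q′ ⟨
    (q + q′) * + N      ∎)
    where open ≡-Reasoning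
          split : ∀ a b c d → (a + c) - (b + d) ≡ (a - b) + (c - d)
          split = solve-∀

  *-cong : ∀ {a b c d} → a ≈ b → c ≈ d → a * c ≈ b * d
  *-cong {a} {b} {c} {d} (q , eq) (q′ , eq′) = q * c + b * q′ , (begin
    a * c - b * d                 ≡⟨ split a b c d ⟩
    (a - b) * c + b * (c - d)     ≡⟨ cong₂ (λ x y → x * c + b * y) eq eq′ ⟩
    q * + N * c + b * (q′ * + N)  ≡⟨ collect q (+ N) c b q′ ⟩
    (q * c + b * q′) * + N        ∎)
    where open ≡-Reasoning
          split : ∀ a b c d → a * c - b * d ≡ (a - b) * c + b * (c - d)
          split = solve-∀
          collect : ∀ q n c b q′ → q * n * c + b * (q′ * n) ≡ (q * c + b * q′) * n
          collect = solve-∀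

  isCommutativeRing : IsCommutativeRing _≈_ _+_ _*_ -_ (+ 0) (+ 1)
  isCommutativeRing = record
    { isRing = record
      { +-isAbelianGroup = record
        { isGroup = record
          { isMonoid = record
            { isSemigroup = record
              { isMagma = record
                { isEquivalence = record { refl = ≈-refl ; sym = ≈-sym ; trans = ≈-trans }
                ; ∙-cong = +-cong }
              ; assoc = λ x y z → ≡⇒≈ (ℤ.+-assoc x y z) }
            ; identity = (λ x → ≡⇒≈ (ℤ.+-identityˡ x)) , (λ x → ≡⇒≈ (ℤ.+-identityʳ x)) }
          ; inverse = (λ x → ≡⇒≈ (ℤ.+-inverseˡ x)) , (λ x → ≡⇒≈ (ℤ.+-inverseʳ x))
          ; ⁻¹-cong = -‿cong }
        ; comm = λ x y → ≡⇒≈ (ℤ.+-comm x y) }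
      ; *-cong = *-cong
      ; *-assoc = λ x y z → ≡⇒≈ (ℤ.*-assoc x y z)
      ; *-identity = (λ x → ≡⇒≈ (ℤ.*-identityˡ x)) , (λ x → ≡⇒≈ (ℤ.*-identityʳ x))
      ; distrib = (λ x y z → ≡⇒≈ (ℤ.*-distribˡ-+ x y z)) , (λ x y z → ≡⇒≈ (ℤ.*-distribʳ-+ x y z)) }
    ; *-comm = λ x y → ≡⇒≈ (ℤ.*-comm x y) }

  ℤ/N : CommutativeRing _ _
  ℤ/N = record { isCommutativeRing = isCommutativeRing }

  module ≈-Reasoning = SetoidReasoning (CommutativeRing.setoid ℤ/N)

  N≈0 : + N ≈ + 0
  N≈0 = + 1 , trans (ℤ.+-identityʳ (+ N)) (sym (ℤ.*-identityˡ (+ N)))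

  ^-cong : ∀ {a b} t → a ≈ b → a ^ t ≈ b ^ t
  ^-cong ℕ.zero    a≈b = ≈-refl
  ^-cong (ℕ.suc t) a≈b = *-cong a≈b (^-cong t a≈b)

  inverse-unique : ∀ {x y t} → x * t ≈ + 1 → y * t ≈ + 1 → x ≈ y
  inverse-unique {x} {y} {t} xt≈1 yt≈1 = begin
    x              ≡⟨ ℤ.*-identityʳ x ⟨
    x * + 1        ≈⟨ *-cong (≈-refl {x}) (≈-sym yt≈1) ⟩
    x * (y * t)    ≡⟨ swap x y t ⟩
    y * (x * t)    ≈⟨ *-cong (≈-refl {y}) xt≈1 ⟩
    y * + 1        ≡⟨ ℤ.*-identityʳ y ⟩
    y              ∎
    where open ≈-Reasoning
          swap : ∀ x y t → x * (y * t) ≡ y * (x * t)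
          swap = solve-∀

  cancelˡ : ∀ {u v a b} → u * v ≈ + 1 → u * a ≈ u * b → a ≈ b
  cancelˡ {u} {v} {a} {b} uv≈1 ua≈ub = begin
    a              ≡⟨ ℤ.*-identityˡ a ⟨
    + 1 * a        ≈⟨ *-cong (≈-sym uv≈1) (≈-refl {a}) ⟩
    u * v * a      ≡⟨ swap u v a ⟩
    v * (u * a)    ≈⟨ *-cong (≈-refl {v}) ua≈ub ⟩
    v * (u * b)    ≡⟨ swap u v b ⟨
    u * v * b      ≈⟨ *-cong uv≈1 (≈-refl {b}) ⟩
    + 1 * b        ≡⟨ ℤ.*-identityˡ b ⟩
    b              ∎
    where open ≈-Reasoning
          swap : ∀ u v a → u * v * a ≡ v * (u * a)
          swap = solve-∀

  ∣-∣-cast : ∀ a b → ∣ + a - + b ∣ ≡ ℕ.∣ a - b ∣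
  ∣-∣-cast a b with ℕ.≤-total a b
  ... | inj₁ a≤b = trans (cong ∣_∣ (ℤ.m-n≡m⊖n a b))
                     (trans (ℤ.∣⊖∣-≤ a≤b) (sym (ℕ.m≤n⇒∣m-n∣≡n∸m a≤b)))
  ... | inj₂ b≤a = trans (cong ∣_∣ (ℤ.m-n≡m⊖n a b))
                     (trans (ℤ.∣m⊖n∣≡∣n⊖m∣ a b)
                       (trans (ℤ.∣⊖∣-≤ b≤a) (sym (ℕ.m≤n⇒∣n-m∣≡n∸m b≤a))))

  ≈⇒≡[mod] : ∀ {a b} → + a ≈ + b → a ≡ b [mod N ]
  ≈⇒≡[mod] {a} {b} (q , eq) = divides ∣ q ∣ (begin
    ℕ.∣ a - b ∣      ≡⟨ ∣-∣-cast a b ⟨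
    ∣ + a - + b ∣    ≡⟨ cong ∣_∣ eq ⟩
    ∣ q * + N ∣      ≡⟨ ℤ.abs-* q (+ N) ⟩
    ∣ q ∣ ℕ.* N      ∎)
    where open ≡-Reasoning

  ≡[mod]⇒≈ : ∀ {a b} → a ≡ b [mod N ] → + a ≈ + b
  ≡[mod]⇒≈ {a} {b} (divides q eq) = from-sign (ℤ.+∣i∣≡i⊎+∣i∣≡-i (+ a - + b))
    where
    open ≡-Reasoning
    abs≡multiple : + ∣ + a - + b ∣ ≡ + q * + N
    abs≡multiple = trans (cong +_ (trans (∣-∣-cast a b) eq)) (ℤ.pos-* q N)
    from-sign : + ∣ + a - + b ∣ ≡ + a - + b ⊎ + ∣ + a - + b ∣ ≡ - (+ a - + b) → + a ≈ + b
    from-sign (inj₁ abs≡) = + q , trans (sym abs≡) abs≡multiple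
    from-sign (inj₂ abs≡) = - + q , (begin
      + a - + b          ≡⟨ ℤ.neg-involutive (+ a - + b) ⟨
      - (- (+ a - + b))  ≡⟨ cong -_ (trans (sym abs≡) abs≡multiple) ⟩
      - (+ q * + N)      ≡⟨ ℤ.neg-distribˡ-* (+ q) (+ N) ⟩
      - + q * + N        ∎)

  ≈-residue : ∀ {a b} → a < N → b < N → + a ≈ + b → a ≡ b
  ≈-residue {a} {b} a<N b<N a≈b =
    ℕ.∣m-n∣≡0⇒m≡n (multiple-below-N (≈⇒≡[mod] a≈b) (ℕ.≤-<-trans (ℕ.∣m-n∣≤m⊔n a b) (ℕ.⊔-lub a<N b<N)))
    where
    multiple-below-N : ∀ {x} → N ∣ x → x < N → x ≡ 0
    multiple-below-N {ℕ.zero}  _   _   = refl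
    multiple-below-N {ℕ.suc x} N∣x x<N = contradiction N∣x (>⇒∤ x<N)

  -≈+-complement : ∀ a b k c → b ℕ.+ k ≡ N ℕ.* c → + a - + k ≈ + (a ℕ.+ b)
  -≈+-complement a b k c b+k≡Nc = - + c , (begin
    + a - + k - + (a ℕ.+ b)      ≡⟨ cong (λ x → + a - + k - x) (ℤ.pos-+ a b) ⟩
    + a - + k - (+ a + + b)      ≡⟨ regroup (+ a) (+ b) (+ k) ⟩
    - (+ b + + k)                ≡⟨ cong -_ (ℤ.pos-+ b k) ⟨
    - + (b ℕ.+ k)                ≡⟨ cong (λ x → - + x) b+k≡Nc ⟩
    - + (N ℕ.* c)                ≡⟨ cong -_ (trans (ℤ.pos-* N c) (ℤ.*-comm (+ N) (+ c))) ⟩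
    - (+ c * + N)                ≡⟨ ℤ.neg-distribˡ-* (+ c) (+ N) ⟩
    - + c * + N                  ∎)
    where open ≡-Reasoning
          regroup : ∀ a b k → a - k - (a + b) ≡ - (b + k)
          regroup = solve-∀

  %ℕ-≈ : ∀ x .{{_ : ℕ.NonZero N}} → + (x %ℕ N) ≈ x
  %ℕ-≈ x = - (x /ℕ N) , (begin
    + (x %ℕ N) - x                                       ≡⟨ cong (λ y → + (x %ℕ N) - y) (a≡a%ℕn+[a/ℕn]*n x N) ⟩
    + (x %ℕ N) - (+ (x %ℕ N) + x /ℕ N * + N)             ≡⟨ cancel (+ (x %ℕ N)) (x /ℕ N) (+ N) ⟩
    - (x /ℕ N) * + N                                     ∎)
    where open ≡-Reasoning
          cancel : ∀ r q n → r - (r + q * n) ≡ - q * n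
          cancel = solve-∀

  ≈-difference : ∀ {a b} → a ≈ b → a - b ≈ + 0
  ≈-difference {a} {b} (q , eq) = q , trans (ℤ.+-identityʳ (a - b)) eq

  ≈-by-certificate : ∀ {x y d₁ d₂ d₃} a b c → x ≡ y + a * d₁ + b * d₂ + c * d₃ →
                     d₁ ≈ + 0 → d₂ ≈ + 0 → d₃ ≈ + 0 → x ≈ y
  ≈-by-certificate {x} {y} {d₁} {d₂} {d₃} a b c x≡ d₁≈0 d₂≈0 d₃≈0 = begin
    x                                    ≡⟨ x≡ ⟩
    y + a * d₁ + b * d₂ + c * d₃         ≈⟨ +-cong (+-cong (+-cong (≈-refl {y}) (*-cong (≈-refl {a}) d₁≈0)) (*-cong (≈-refl {b}) d₂≈0)) (*-cong (≈-refl {c}) d₃≈0) ⟩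
    y + a * + 0 + b * + 0 + c * + 0      ≡⟨ vanish y a b c ⟩
    y                                    ∎
    where open ≈-Reasoning
          vanish : ∀ y a b c → y + a * + 0 + b * + 0 + c * + 0 ≡ y
          vanish = solve-∀

  -- As y z ≈ 1, K z² ≈ 1 - z + z²; and 2u ≈ c, both being inverse to t, so
  -- 2S ≈ c (A₁ + A₂) - 2A₁ ≈ T₂ + c T₁ - 2A₁.
  K-inverse : ∀ {y z h u t c A₁ A₂ T₁ T₂} →
    y * z ≈ + 1 → + 2 * h ≈ + 1 → + 2 * u * t ≈ + 1 → c * t ≈ + 1 →
    A₁ + A₂ ≈ T₁ + t * T₂ → (+ 1 - z + z * z) * (T₂ + c * T₁ - + 2 * A₁) ≈ + 2 * z * z →
    (y * y - y + + 1) * ((u - + 1) * A₁ + u * A₂) ≈ + 1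
  K-inverse {y} {z} {h} {u} {t} {c} {A₁} {A₂} {T₁} {T₂} yz≈1 2h≈1 2ut≈1 ct≈1 sum≈ D≈ =
    cancelˡ {+ 2 * z * z} {h * y * y} unit (begin
      + 2 * z * z * (K * S)                          ≡⟨ regroup z K S ⟩
      (K * (z * z)) * (+ 2 * S)                      ≈⟨ *-cong Kz²≈D 2S≈ ⟩
      D * (T₂ + c * T₁ - + 2 * A₁)                   ≈⟨ D≈ ⟩
      + 2 * z * z                                    ≡⟨ ℤ.*-identityʳ (+ 2 * z * z) ⟨
      + 2 * z * z * + 1                              ∎)
    where
    open ≈-Reasoning
    K = y * y - y + + 1
    S = (u - + 1) * A₁ + u * A₂
    D = + 1 - z + z * z
    regroup : ∀ z K S → + 2 * z * z * (K * S) ≡ (K * (z * z)) * (+ 2 * S)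
    regroup = solve-∀
    unit : + 2 * z * z * (h * y * y) ≈ + 1
    unit = begin
      + 2 * z * z * (h * y * y)        ≡⟨ regroup′ h y z ⟩
      (+ 2 * h) * ((y * z) * (y * z))  ≈⟨ *-cong 2h≈1 (*-cong yz≈1 yz≈1) ⟩
      + 1                              ∎
      where regroup′ : ∀ h y z → + 2 * z * z * (h * y * y) ≡ (+ 2 * h) * ((y * z) * (y * z))
            regroup′ = solve-∀
    Kz²≈D : K * (z * z) ≈ D
    Kz²≈D = begin
      K * (z * z)                                  ≡⟨ expand y z ⟩
      (y * z) * (y * z) - (y * z) * z + z * z      ≈⟨ +-cong (+-cong (*-cong yz≈1 yz≈1) (-‿cong (*-cong yz≈1 (≈-refl {z})))) (≈-refl {z * z}) ⟩
      + 1 * + 1 - + 1 * z + z * z                  ≡⟨ simplify z ⟩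
      D                                            ∎
      where expand : ∀ y z → (y * y - y + + 1) * (z * z) ≡ (y * z) * (y * z) - (y * z) * z + z * z
            expand = solve-∀
            simplify : ∀ z → + 1 * + 1 - + 1 * z + z * z ≡ + 1 - z + z * z
            simplify = solve-∀
    2S≈ : + 2 * S ≈ T₂ + c * T₁ - + 2 * A₁
    2S≈ = begin
      + 2 * S                                       ≡⟨ expand u A₁ A₂ ⟩
      (+ 2 * u) * (A₁ + A₂) - + 2 * A₁              ≈⟨ +-cong (*-cong (inverse-unique {+ 2 * u} {c} {t} 2ut≈1 ct≈1) sum≈) (≈-refl { - (+ 2 * A₁)}) ⟩
      c * (T₁ + t * T₂) - + 2 * A₁                  ≡⟨ regroup′ c t T₁ T₂ (+ 2 * A₁) ⟩
      (c * t) * T₂ + c * T₁ - + 2 * A₁              ≈⟨ +-cong (+-cong (*-cong ct≈1 (≈-refl {T₂})) (≈-refl {c * T₁})) (≈-refl { - (+ 2 * A₁)}) ⟩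
      + 1 * T₂ + c * T₁ - + 2 * A₁                  ≡⟨ cong (λ x → x + c * T₁ - + 2 * A₁) (ℤ.*-identityˡ T₂) ⟩
      T₂ + c * T₁ - + 2 * A₁                        ∎
      where expand : ∀ u A₁ A₂ → + 2 * ((u - + 1) * A₁ + u * A₂) ≡ (+ 2 * u) * (A₁ + A₂) - + 2 * A₁
            expand = solve-∀
            regroup′ : ∀ c t T₁ T₂ a → c * (T₁ + t * T₂) - a ≡ (c * t) * T₂ + c * T₁ - a
            regroup′ = solve-∀

module Scaling where
  open import Data.Integer using (ℤ; +_; _-_; _*_)
  import Data.Integer.Properties as ℤ
  open import Data.Integer.Tactic.RingSolver using (solve-∀)
  open import Data.Nat as ℕ using (ℕ)
  open import Relation.Binary.PropositionalEquality

  ≈-scale : ∀ {M a b} k → IntegersModulo._≈_ M a b → IntegersModulo._≈_ (k ℕ.* M) (+ k * a) (+ k * b)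
  ≈-scale {M} {a} {b} k (q IntegersModulo., eq) = q IntegersModulo., (begin
    + k * a - + k * b      ≡⟨ factor (+ k) a b ⟩
    + k * (a - b)          ≡⟨ cong (+ k *_) eq ⟩
    + k * (q * + M)        ≡⟨ swap (+ k) q (+ M) ⟩
    q * (+ k * + M)        ≡⟨ cong (q *_) (ℤ.pos-* k M) ⟨
    q * + (k ℕ.* M)        ∎)
    where open ≡-Reasoning
          swap : ∀ k q M → k * (q * M) ≡ q * (k * M)
          swap = solve-∀
          factor : ∀ k a b → k * a - k * b ≡ k * (a - b)
          factor = solve-∀

module FiniteSums where

  open import Data.Fin using (Fin; zero; suc; toℕ)
  open import Data.Integer using (+_; _+_)
  import Data.Integer.Properties as ℤ
  open import Data.List using (applyUpTo)
  open import Data.List.Properties using (map-upTo)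
  open import Data.Nat as ℕ using (ℕ)
  open import Data.Nat.ListAction using (sum)
  open import Relation.Binary.PropositionalEquality
  open import Defs using (Σ<)

  Σ<-as-∑ : ∀ k f → Σ< k f ≡ Σℕ.sum (λ (i : Fin k) → f (toℕ i))
  Σ<-as-∑ k f = trans (cong sum (map-upTo f k)) (applyUpTo-as-∑ k f)
    where
    applyUpTo-as-∑ : ∀ k f → sum (applyUpTo f k) ≡ Σℕ.sum (λ (i : Fin k) → f (toℕ i))
    applyUpTo-as-∑ ℕ.zero    f = refl
    applyUpTo-as-∑ (ℕ.suc k) f = cong (f 0 ℕ.+_) (applyUpTo-as-∑ k (λ i → f (ℕ.suc i)))

  sum-cast : ∀ {k} (f : Fin k → ℕ) → + Σℕ.sum f ≡ Σℤ.sum (λ i → + f i)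
  sum-cast {ℕ.zero}  f = refl
  sum-cast {ℕ.suc k} f = trans (ℤ.pos-+ (f zero) _) (cong (λ x → + f zero + x) (sum-cast (λ i → f (suc i))))

  sum-const : ∀ k x → Σℕ.sum {k} (λ _ → x) ≡ k ℕ.* x
  sum-const ℕ.zero    x = refl
  sum-const (ℕ.suc k) x = cong (x ℕ.+_) (sum-const k x)

module BinaryWeight where

  open Σℕ using (sum; sum-cong-≗; *-distribˡ-sum)
  open import Data.Fin using (Fin; zero; suc; toℕ)
  open import Data.Nat using (ℕ; zero; suc; _+_; _*_; _^_; _/_; _%_; _<_; _≤_; z≤n; s≤s)
  open import Algebra.Properties.CommutativeSemigroup Data.Nat.Properties.*-commutativeSemigroup
    using (x∙yz≈y∙xz)
  open import Data.Nat.DivMod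
  open import Data.Nat.Divisibility using (divides)
  open import Data.Nat.Properties
  open import Data.Product using (_×_; _,_)
  open import Relation.Binary.PropositionalEquality
  open import Defs using (wtF; wt)

  wtF-zero : ∀ fuel → wtF fuel 0 ≡ 0
  wtF-zero zero       = refl
  wtF-zero (suc fuel) = wtF-zero fuel

  half≤ : ∀ f x → x ≤ suc f → x / 2 ≤ f
  half≤ f zero    _  = z≤n
  half≤ f (suc x) le = <⇒≤pred (<-≤-trans (m/n<m (suc x) 2 (s≤s (s≤s z≤n))) le)

  wtF-fuel : ∀ f g x → x ≤ f → x ≤ g → wtF f x ≡ wtF g x
  wtF-fuel zero    g .zero z≤n _   = sym (wtF-zero g)
  wtF-fuel (suc f) zero .zero _ z≤n = wtF-zero (suc f)
  wtF-fuel (suc f) (suc g) x lf lg =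
    cong (x % 2 +_) (wtF-fuel f g (x / 2) (half≤ f x lf) (half≤ g x lg))

  wt-halve : ∀ x → wt x ≡ x % 2 + wt (x / 2)
  wt-halve zero    = refl
  wt-halve (suc y) =
    cong (suc y % 2 +_) (wtF-fuel y (suc y / 2) (suc y / 2) (half≤ y (suc y) ≤-refl) ≤-refl)

  wt-+-shifted : ∀ k a b → a < 2 ^ k → wt (a + 2 ^ k * b) ≡ wt a + wt b
  wt-+-shifted zero    zero    b _        = cong wt (+-identityʳ b)
  wt-+-shifted zero    (suc a) b (s≤s ())
  wt-+-shifted (suc k) a       b a<2^[1+k] = begin
    wt (a + 2 ^ suc k * b)                                      ≡⟨ cong (λ x → wt (a + x)) double ⟩
    wt (a + (2 ^ k * b) * 2)                                    ≡⟨ wt-halve (a + (2 ^ k * b) * 2) ⟩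
    (a + (2 ^ k * b) * 2) % 2 + wt ((a + (2 ^ k * b) * 2) / 2)  ≡⟨ cong₂ (λ x y → x + wt y) ([m+kn]%n≡m%n a (2 ^ k * b) 2) halve ⟩
    a % 2 + wt (a / 2 + 2 ^ k * b)                              ≡⟨ cong (a % 2 +_) (wt-+-shifted k (a / 2) b a/2<2^k) ⟩
    a % 2 + (wt (a / 2) + wt b)                                 ≡⟨ +-assoc (a % 2) _ _ ⟨
    a % 2 + wt (a / 2) + wt b                                   ≡⟨ cong (_+ wt b) (wt-halve a) ⟨
    wt a + wt b                                                 ∎
    where
    open ≡-Reasoning
    double : 2 ^ suc k * b ≡ (2 ^ k * b) * 2
    double = trans (*-assoc 2 (2 ^ k) b) (*-comm 2 (2 ^ k * b))
    halve : (a + (2 ^ k * b) * 2) / 2 ≡ a / 2 + 2 ^ k * b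
    halve = trans (+-distrib-/-∣ʳ a (divides (2 ^ k * b) refl)) (cong (a / 2 +_) (m*n/n≡m (2 ^ k * b) 2))
    a/2<2^k : a / 2 < 2 ^ k
    a/2<2^k = m<n*o⇒m/o<n (subst (a <_) (*-comm 2 (2 ^ k)) a<2^[1+k])

  digits-split : ∀ k {m} (f : Fin (suc m) → ℕ) →
    sum (λ t → f t * 2 ^ (k * toℕ t))
      ≡ f zero + 2 ^ k * sum (λ t → f (suc t) * 2 ^ (k * toℕ t))
  digits-split k f = cong₂ _+_
    (trans (cong (λ x → f zero * 2 ^ x) (*-zeroʳ k)) (*-identityʳ (f zero)))
    (trans (sum-cong-≗ (λ t → shift (f (suc t)) (toℕ t)))
           (sym (*-distribˡ-sum (2 ^ k) (λ t → f (suc t) * 2 ^ (k * toℕ t)))))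
    where
    shift : ∀ c t → c * 2 ^ (k * suc t) ≡ 2 ^ k * (c * 2 ^ (k * t))
    shift c t = begin
      c * 2 ^ (k * suc t)          ≡⟨ cong (λ x → c * 2 ^ x) (*-suc k t) ⟩
      c * 2 ^ (k + k * t)          ≡⟨ cong (c *_) (^-distribˡ-+-* 2 k (k * t)) ⟩
      c * (2 ^ k * 2 ^ (k * t))    ≡⟨ x∙yz≈y∙xz c (2 ^ k) (2 ^ (k * t)) ⟩
      2 ^ k * (c * 2 ^ (k * t))    ∎
      where open ≡-Reasoning

  digits-< : ∀ k {m} (f : Fin m → ℕ) → (∀ t → f t < 2 ^ k) →
    sum (λ t → f t * 2 ^ (k * toℕ t)) < 2 ^ (k * m)
  digits-< k {zero}  f f<2^k = subst (0 <_) (cong (2 ^_) (sym (*-zeroʳ k))) (m^n>0 2 0)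
  digits-< k {suc m} f f<2^k = begin-strict
    sum (λ t → f t * 2 ^ (k * toℕ t))  ≡⟨ digits-split k f ⟩
    f zero + 2 ^ k * rest              <⟨ +-monoˡ-< (2 ^ k * rest) (f<2^k zero) ⟩
    2 ^ k + 2 ^ k * rest               ≡⟨ *-suc (2 ^ k) rest ⟨
    2 ^ k * suc rest                   ≤⟨ *-monoʳ-≤ (2 ^ k) (digits-< k (λ t → f (suc t)) (λ t → f<2^k (suc t))) ⟩
    2 ^ k * 2 ^ (k * m)                ≡⟨ ^-distribˡ-+-* 2 k (k * m) ⟨
    2 ^ (k + k * m)                    ≡⟨ cong (2 ^_) (*-suc k m) ⟨
    2 ^ (k * suc m)                    ∎
    where open ≤-Reasoning
          rest = sum (λ t → f (suc t) * 2 ^ (k * toℕ t))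

  wt-digits : ∀ k {m} (f : Fin m → ℕ) → (∀ t → f t < 2 ^ k) →
    wt (sum (λ t → f t * 2 ^ (k * toℕ t))) ≡ sum (λ t → wt (f t))
  wt-digits k {zero}  f f<2^k = refl
  wt-digits k {suc m} f f<2^k = begin
    wt (sum (λ t → f t * 2 ^ (k * toℕ t)))                            ≡⟨ cong wt (digits-split k f) ⟩
    wt (f zero + 2 ^ k * sum (λ t → f (suc t) * 2 ^ (k * toℕ t)))     ≡⟨ wt-+-shifted k (f zero) _ (f<2^k zero) ⟩
    wt (f zero) + wt (sum (λ t → f (suc t) * 2 ^ (k * toℕ t)))        ≡⟨ cong (wt (f zero) +_) (wt-digits k (λ t → f (suc t)) (λ t → f<2^k (suc t))) ⟩
    wt (f zero) + sum (λ t → wt (f (suc t)))                          ∎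
    where open ≡-Reasoning

  wt-bit : ∀ c → c ≤ 1 → wt c ≡ c
  wt-bit zero          _         = refl
  wt-bit (suc zero)    _         = refl
  wt-bit (suc (suc c)) (s≤s ())

  binary-expansion : ∀ {d} (c : Fin d → ℕ) → (∀ i → c i ≤ 1) →
    sum (λ i → c i * 2 ^ toℕ i) < 2 ^ d × wt (sum (λ i → c i * 2 ^ toℕ i)) ≡ sum c
  binary-expansion {d} c c≤1 =
    subst₂ _<_ base-1 (cong (2 ^_) (*-identityˡ d)) (digits-< 1 c (λ i → s≤s (c≤1 i))) ,
    trans (cong wt (sym base-1)) (trans (wt-digits 1 c (λ i → s≤s (c≤1 i))) (sum-cong-≗ (λ i → wt-bit (c i) (c≤1 i))))
    where
    base-1 : sum (λ i → c i * 2 ^ (1 * toℕ i)) ≡ sum (λ i → c i * 2 ^ toℕ i)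
    base-1 = sum-cong-≗ (λ i → cong (λ x → c i * 2 ^ x) (*-identityˡ (toℕ i)))

module IntegerCasts where
  open import Data.Integer using (ℤ; +_; _+_; _-_; _*_; _^_)
  import Data.Integer.Properties as ℤ
  open import Data.Nat as ℕ using (ℕ)
  import Data.Nat.Properties as ℕ
  open import Relation.Binary.PropositionalEquality
  open import Defs using (K)

  two : ℤ
  two = + 2

  pos-^ : ∀ a k → + (a ℕ.^ k) ≡ (+ a) ^ k
  pos-^ a ℕ.zero    = refl
  pos-^ a (ℕ.suc k) = trans (ℤ.pos-* a (a ℕ.^ k)) (cong (+ a *_) (pos-^ a k))

  K-cast : ∀ r → + K r ≡ two ^ r * two ^ r - two ^ r + + 1
  K-cast r = begin
    + (2 ℕ.^ (2 ℕ.* r) ℕ.∸ 2 ℕ.^ r ℕ.+ 1)                ≡⟨ ℤ.pos-+ (2 ℕ.^ (2 ℕ.* r) ℕ.∸ 2 ℕ.^ r) 1 ⟩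
    + (2 ℕ.^ (2 ℕ.* r) ℕ.∸ 2 ℕ.^ r) + + 1                ≡⟨ cong (_+ + 1) (trans (ℤ.m-n≡m⊖n (2 ℕ.^ (2 ℕ.* r)) (2 ℕ.^ r)) (ℤ.⊖-≥ 2^r≤2^2r)) ⟨
    + (2 ℕ.^ (2 ℕ.* r)) - + (2 ℕ.^ r) + + 1              ≡⟨ cong₂ (λ a b → a - b + + 1) (pos-^ 2 (2 ℕ.* r)) (pos-^ 2 r) ⟩
    two ^ (r ℕ.+ (r ℕ.+ 0)) - two ^ r + + 1          ≡⟨ cong (λ x → x - two ^ r + + 1) (trans (cong (two ^_) (cong (r ℕ.+_) (ℕ.+-identityʳ r))) (ℤ.^-distribˡ-+-* two r r)) ⟩
    two ^ r * two ^ r - two ^ r + + 1              ∎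
    where open ≡-Reasoning
          2^r≤2^2r : 2 ℕ.^ r ℕ.≤ 2 ℕ.^ (2 ℕ.* r)
          2^r≤2^2r = ℕ.^-monoʳ-≤ 2 (ℕ.m≤m+n r (r ℕ.+ 0))

module PowersOfTwo (n′ : Data.Nat.ℕ) where

  open import Data.Integer using (ℤ; +_; _+_; _-_; _*_; _^_)
  import Data.Integer.Properties as ℤ
  open import Data.Integer.Tactic.RingSolver using (solve-∀)
  open import Data.Nat as ℕ using (ℕ; suc; _∸_)
  import Data.Nat.Properties as ℕ
  open import Relation.Binary.PropositionalEquality

  N : ℕ
  N = 2 ℕ.^ suc n′ ∸ 1

  open IntegersModulo N
  open IntegerCasts using (two; pos-^)


  2^n≈1 : two ^ suc n′ ≈ + 1
  2^n≈1 = + 1 , (begin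
    two ^ suc n′ - + 1       ≡⟨ cong (_- + 1) (pos-^ 2 (suc n′)) ⟨
    + (2 ℕ.^ suc n′) - + 1   ≡⟨ cong (λ x → + x - + 1) (ℕ.m∸n+n≡m (ℕ.m^n>0 2 (suc n′))) ⟨
    + (N ℕ.+ 1) - + 1        ≡⟨ cong (_- + 1) (ℤ.pos-+ N 1) ⟩
    + N + + 1 - + 1          ≡⟨ cancel (+ N) ⟩
    + 1 * + N                ∎)
    where open ≡-Reasoning
          cancel : ∀ x → x + + 1 - + 1 ≡ + 1 * x
          cancel = solve-∀

  2^[n*c]≈1 : ∀ c → two ^ (suc n′ ℕ.* c) ≈ + 1
  2^[n*c]≈1 c = begin
    two ^ (suc n′ ℕ.* c)   ≡⟨ ℤ.^-*-assoc two (suc n′) c ⟨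
    (two ^ suc n′) ^ c     ≈⟨ ^-cong c 2^n≈1 ⟩
    (+ 1) ^ c              ≡⟨ ℤ.^-zeroˡ c ⟩
    + 1                    ∎
    where open ≈-Reasoning

  2^a*2^b≈1 : ∀ a b c → a ℕ.+ b ≡ suc n′ ℕ.* c → two ^ a * two ^ b ≈ + 1
  2^a*2^b≈1 a b c a+b≡nc = begin
    two ^ a * two ^ b      ≡⟨ ℤ.^-distribˡ-+-* two a b ⟨
    two ^ (a ℕ.+ b)        ≡⟨ cong (two ^_) a+b≡nc ⟩
    two ^ (suc n′ ℕ.* c)   ≈⟨ 2^[n*c]≈1 c ⟩
    + 1                    ∎
    where open ≈-Reasoning

module CoefficientLists where

  open import Algebra.Properties.CommutativeSemigroup Data.Integer.Properties.*-commutativeSemigroup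
    using (x∙yz≈y∙xz)
  open import Data.Fin using (Fin; zero; suc; toℕ)
  open import Data.Integer using (ℤ; +_; _+_; _-_; _*_; _^_)
  import Data.Integer.Properties as ℤ
  open import Data.Integer.Tactic.RingSolver using (solve-∀)
  open import Data.List using (List; []; _∷_; _++_; length)
  open import Data.List.Properties using (length-++)
  open import Data.List.Relation.Unary.All using (All; []; _∷_; all?)
  open import Data.List.Relation.Unary.All.Properties using (++⁺)
  open import Data.Nat as ℕ using (ℕ; zero; suc; _≤_; _≤?_; z≤n)
  import Data.Nat.Properties as ℕ
  open import Data.Nat.ListAction using (sum)
  open import Data.Nat.ListAction.Properties using (sum-++)
  open import Relation.Binary.PropositionalEquality
  open import Relation.Nullary.Decidable using (True; toWitness)
  open import Defs using (rep; nth; x₁; x₂; x₃; x₄; x₅; x₆)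

  ev : ℤ → List ℕ → ℤ
  ev z []       = + 0
  ev z (a ∷ as) = + a + z * ev z as

  geometric : ℤ → ℕ → ℤ
  geometric w zero    = + 0
  geometric w (suc q) = + 1 + w * geometric w q

  geometric-closed : ∀ w q → w ^ q ≡ + 1 + (w - + 1) * geometric w q
  geometric-closed w zero    = sym (trans (cong (λ x → + 1 + x) (ℤ.*-zeroʳ (w - + 1))) (ℤ.+-identityʳ (+ 1)))
  geometric-closed w (suc q) = begin
    w * w ^ q                                        ≡⟨ cong (w *_) (geometric-closed w q) ⟩
    w * (+ 1 + (w - + 1) * geometric w q)            ≡⟨ telescope w (geometric w q) ⟩
    + 1 + (w - + 1) * (+ 1 + w * geometric w q)      ∎
    where open ≡-Reasoning
          telescope : ∀ w g → w * (+ 1 + (w - + 1) * g) ≡ + 1 + (w - + 1) * (+ 1 + w * g)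
          telescope = solve-∀

  geometric-as-sum : ∀ w q → Σℤ.sum (λ (t : Fin q) → w ^ toℕ t) ≡ geometric w q
  geometric-as-sum w zero    = refl
  geometric-as-sum w (suc q) = cong (λ x → + 1 + x) (begin
    Σℤ.sum {q} (λ t → w * w ^ toℕ t)   ≡⟨ Σℤ.*-distribˡ-sum {q} w (λ t → w ^ toℕ t) ⟨
    w * Σℤ.sum {q} (λ t → w ^ toℕ t)   ≡⟨ cong (w *_) (geometric-as-sum w q) ⟩
    w * geometric w q              ∎)
    where open ≡-Reasoning

  ev-++ : ∀ z xs ys → ev z (xs ++ ys) ≡ ev z xs + z ^ length xs * ev z ys
  ev-++ z []       ys = sym (trans (ℤ.+-identityˡ _) (ℤ.*-identityˡ (ev z ys)))
  ev-++ z (x ∷ xs) ys = begin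
    + x + z * ev z (xs ++ ys)                          ≡⟨ cong (λ u → + x + z * u) (ev-++ z xs ys) ⟩
    + x + z * (ev z xs + z ^ length xs * ev z ys)      ≡⟨ expand (+ x) z (ev z xs) (z ^ length xs) (ev z ys) ⟩
    + x + z * ev z xs + z * z ^ length xs * ev z ys    ∎
    where open ≡-Reasoning
          expand : ∀ x z a p b → x + z * (a + p * b) ≡ x + z * a + z * p * b
          expand = solve-∀

  ev-rep : ∀ z q xs → ev z (rep q xs) ≡ ev z xs * geometric (z ^ length xs) q
  ev-rep z zero    xs = sym (ℤ.*-zeroʳ (ev z xs))
  ev-rep z (suc q) xs = begin
    ev z (xs ++ rep q xs)                        ≡⟨ ev-++ z xs (rep q xs) ⟩
    ev z xs + w * ev z (rep q xs)                ≡⟨ cong (λ u → ev z xs + w * u) (ev-rep z q xs) ⟩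
    ev z xs + w * (ev z xs * geometric w q)      ≡⟨ factor (ev z xs) w (geometric w q) ⟩
    ev z xs * (+ 1 + w * geometric w q)          ∎
    where open ≡-Reasoning
          w = z ^ length xs
          factor : ∀ a w g → a + w * (a * g) ≡ a * (+ 1 + w * g)
          factor = solve-∀

  length-rep : ∀ q xs → length (rep q xs) ≡ q ℕ.* length xs
  length-rep zero    xs = refl
  length-rep (suc q) xs = trans (length-++ xs) (cong (length xs ℕ.+_) (length-rep q xs))

  sum-rep : ∀ q xs → sum (rep q xs) ≡ q ℕ.* sum xs
  sum-rep zero    xs = refl
  sum-rep (suc q) xs = trans (sum-++ xs (rep q xs)) (cong (sum xs ℕ.+_) (sum-rep q xs))

  ev-as-sum : ∀ z {k} xs → length xs ≡ k → Σℤ.sum {k} (λ j → + nth xs (toℕ j) * z ^ toℕ j) ≡ ev z xs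
  ev-as-sum z []       refl = refl
  ev-as-sum z (x ∷ xs) refl = cong₂ _+_ (ℤ.*-identityʳ (+ x)) (begin
    Σℤ.sum {length xs} (λ j → + nth xs (toℕ j) * (z * z ^ toℕ j))   ≡⟨ Σℤ.sum-cong-≗ {length xs} (λ j → x∙yz≈y∙xz (+ nth xs (toℕ j)) z (z ^ toℕ j)) ⟩
    Σℤ.sum {length xs} (λ j → z * (+ nth xs (toℕ j) * z ^ toℕ j))   ≡⟨ Σℤ.*-distribˡ-sum {length xs} z _ ⟨
    z * Σℤ.sum {length xs} (λ j → + nth xs (toℕ j) * z ^ toℕ j)     ≡⟨ cong (z *_) (ev-as-sum z xs refl) ⟩
    z * ev z xs                                          ∎)
    where open ≡-Reasoning

  sum-as-∑ : ∀ {k} xs → length xs ≡ k → Σℕ.sum {k} (λ j → nth xs (toℕ j)) ≡ sum xs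
  sum-as-∑ []       refl = refl
  sum-as-∑ (x ∷ xs) refl = cong (x ℕ.+_) (sum-as-∑ xs refl)

  Bits : List ℕ → Set
  Bits = All (_≤ 1)

  nth-bit : ∀ {xs} → Bits xs → ∀ j → nth xs j ≤ 1
  nth-bit []       j       = z≤n
  nth-bit (b ∷ bs) zero    = b
  nth-bit (b ∷ bs) (suc j) = nth-bit bs j

  bits-of : ∀ xs → {True (all? (_≤? 1) xs)} → Bits xs
  bits-of xs {p} = toWitness p

  rep-bits : ∀ q {xs} → Bits xs → Bits (rep q xs)
  rep-bits zero    bs = []
  rep-bits (suc q) bs = ++⁺ bs (rep-bits q bs)

  x₃-period : ∀ q L → x₃ (6 ℕ.* q ℕ.+ L) ≡ rep q (x₃ 6) ++ x₃ L
  x₃-period zero    L = refl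
  x₃-period (suc q) L = begin
    x₃ (6 ℕ.* suc q ℕ.+ L)           ≡⟨ cong x₃ (trans (cong (ℕ._+ L) (ℕ.*-suc 6 q)) (ℕ.+-assoc 6 (6 ℕ.* q) L)) ⟩
    x₃ 6 ++ x₃ (6 ℕ.* q ℕ.+ L)       ≡⟨ cong (x₃ 6 ++_) (x₃-period q L) ⟩
    x₃ 6 ++ rep q (x₃ 6) ++ x₃ L     ≡⟨ Data.List.Properties.++-assoc (x₃ 6) (rep q (x₃ 6)) (x₃ L) ⟨
    (x₃ 6 ++ rep q (x₃ 6)) ++ x₃ L   ∎
    where open ≡-Reasoning

  x₅-period : ∀ q L → x₅ (6 ℕ.* q ℕ.+ L) ≡ rep q (x₅ 6) ++ x₅ L
  x₅-period zero    L = refl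
  x₅-period (suc q) L = begin
    x₅ (6 ℕ.* suc q ℕ.+ L)           ≡⟨ cong x₅ (trans (cong (ℕ._+ L) (ℕ.*-suc 6 q)) (ℕ.+-assoc 6 (6 ℕ.* q) L)) ⟩
    x₅ 6 ++ x₅ (6 ℕ.* q ℕ.+ L)       ≡⟨ cong (x₅ 6 ++_) (x₅-period q L) ⟩
    x₅ 6 ++ rep q (x₅ 6) ++ x₅ L     ≡⟨ Data.List.Properties.++-assoc (x₅ 6) (rep q (x₅ 6)) (x₅ L) ⟨
    (x₅ 6 ++ rep q (x₅ 6)) ++ x₅ L   ∎
    where open ≡-Reasoning

  ev-rep-++ : ∀ z q xs ys → let w = z ^ length xs in
    ev z (rep q xs ++ ys) ≡ ev z xs * geometric w q + w ^ q * ev z ys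
  ev-rep-++ z q xs ys = begin
    ev z (rep q xs ++ ys)                                  ≡⟨ ev-++ z (rep q xs) ys ⟩
    ev z (rep q xs) + z ^ length (rep q xs) * ev z ys      ≡⟨ cong₂ (λ a b → a + b * ev z ys) (ev-rep z q xs) power ⟩
    ev z xs * geometric w q + w ^ q * ev z ys              ∎
    where
    open ≡-Reasoning
    w = z ^ length xs
    power : z ^ length (rep q xs) ≡ w ^ q
    power = trans (cong (z ^_) (trans (length-rep q xs) (ℕ.*-comm q (length xs)))) (sym (ℤ.^-*-assoc z (length xs) q))

  geometric-relation : ∀ w q → (w - + 1) * geometric w q - (w ^ q - + 1) ≡ + 0
  geometric-relation w q = trans (cong (λ x → (w - + 1) * geometric w q - (x - + 1)) (geometric-closed w q))
                                 (cancel (w - + 1) (geometric w q))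
    where cancel : ∀ a g → a * g - (+ 1 + a * g - + 1) ≡ + 0
          cancel = solve-∀

  geometric-+ : ∀ w p k → geometric w (p ℕ.+ k) ≡ geometric w p + w ^ p * geometric w k
  geometric-+ w ℕ.zero    k = sym (trans (ℤ.+-identityˡ _) (ℤ.*-identityˡ _))
  geometric-+ w (ℕ.suc p) k = begin
    + 1 + w * geometric w (p ℕ.+ k)                              ≡⟨ cong (λ x → + 1 + w * x) (geometric-+ w p k) ⟩
    + 1 + w * (geometric w p + w ^ p * geometric w k)            ≡⟨ distribute w (geometric w p) (w ^ p) (geometric w k) ⟩
    + 1 + w * geometric w p + w * w ^ p * geometric w k          ∎
    where open ≡-Reasoning
          distribute : ∀ w a b c → + 1 + w * (a + b * c) ≡ + 1 + w * a + w * b * c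
          distribute = solve-∀

  geometric-swap : ∀ w p k → geometric w p + w ^ p * geometric w k ≡ geometric w k + w ^ k * geometric w p
  geometric-swap w p k = trans (sym (geometric-+ w p k)) (trans (cong (geometric w) (ℕ.+-comm p k)) (geometric-+ w k p))

  -- The ring solver neither unfolds ev nor knows ℤ._^_, so z⁶ and the block evaluations
  -- ev-x… are proved on their definitional unfoldings.
  z⁶ : ∀ z → z ^ 6 ≡ z * z * z * z * z * z
  z⁶ = unfold
    where unfold : ∀ z → z * (z * (z * (z * (z * (z * + 1))))) ≡ z * z * z * z * z * z
          unfold = solve-∀

  z^[6q+a] : ∀ z q a → z ^ (6 ℕ.* q ℕ.+ a) ≡ (z ^ 6) ^ q * z ^ a
  z^[6q+a] z q a = trans (ℤ.^-distribˡ-+-* z (6 ℕ.* q) a) (cong (_* z ^ a) (sym (ℤ.^-*-assoc z 6 q)))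

  ev-x₁ : ∀ z → ev z x₁ ≡ z * z * (+ 1 + z + z * z)
  ev-x₁ = horner
    where horner : ∀ z → + 0 + z * (+ 0 + z * (+ 1 + z * (+ 1 + z * (+ 1 + z * (+ 0 + z * + 0))))) ≡ z * z * (+ 1 + z + z * z)
          horner = solve-∀

  ev-x₂ : ∀ z → ev z x₂ ≡ z * z * z * (+ 1 + z + z * z)
  ev-x₂ = horner
    where horner : ∀ z → + 0 + z * (+ 0 + z * (+ 0 + z * (+ 1 + z * (+ 1 + z * (+ 1 + z * + 0))))) ≡ z * z * z * (+ 1 + z + z * z)
          horner = solve-∀

  ev-x₄ : ∀ z → ev z x₄ ≡ + 1 + z + z * z
  ev-x₄ = horner
    where horner : ∀ z → + 1 + z * (+ 1 + z * (+ 1 + z * (+ 0 + z * (+ 0 + z * (+ 0 + z * + 0))))) ≡ + 1 + z + z * z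
          horner = solve-∀

  ev-x₆ : ∀ z → ev z x₆ ≡ z * (+ 1 + z + z * z)
  ev-x₆ = horner
    where horner : ∀ z → + 0 + z * (+ 1 + z * (+ 1 + z * (+ 1 + z * (+ 0 + z * (+ 0 + z * + 0))))) ≡ z * (+ 1 + z + z * z)
          horner = solve-∀

  ev-x₃ : ∀ z → ev z (x₃ 6) ≡ + 1 + z * z + z * z * z * z
  ev-x₃ = horner
    where horner : ∀ z → + 1 + z * (+ 0 + z * (+ 1 + z * (+ 0 + z * (+ 1 + z * (+ 0 + z * + 0))))) ≡ + 1 + z * z + z * z * z * z
          horner = solve-∀

  ev-x₅ : ∀ z → ev z (x₅ 6) ≡ z * (+ 1 + z * z + z * z * z * z)
  ev-x₅ = horner
    where horner : ∀ z → + 0 + z * (+ 1 + z * (+ 0 + z * (+ 1 + z * (+ 0 + z * (+ 1 + z * + 0))))) ≡ z * (+ 1 + z * z + z * z * z * z)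
          horner = solve-∀

module OddOrder (N : Data.Nat.ℕ) where
  open import Data.Integer using (ℤ; +_; _+_; _-_; _*_; _^_)
  import Data.Integer.Properties as ℤ
  open import Data.Integer.Tactic.RingSolver using (solve-∀)
  open import Data.Nat as ℕ using (ℕ)
  open import Relation.Binary.PropositionalEquality
  open IntegersModulo N
  open CoefficientLists using (geometric; geometric-closed; z⁶)

  geometric-cube-squares : ∀ y v → let W = y * y * y; H = geometric (y ^ 6) v in
                             (+ 1 - W * W) * H ≡ + 1 - (y ^ 6) ^ v
  geometric-cube-squares y v = begin
    (+ 1 - y * y * y * (y * y * y)) * H                     ≡⟨ solve-for (y * y * y) H ⟩
    + 1 - (+ 1 + (y * y * y * (y * y * y) - + 1) * H)       ≡⟨ cong (λ ω → + 1 - (+ 1 + (ω - + 1) * H)) (trans (sixth y) (sym (z⁶ y))) ⟩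
    + 1 - (+ 1 + (y ^ 6 - + 1) * H)                         ≡⟨ cong (λ x → + 1 - x) (geometric-closed (y ^ 6) v) ⟨
    + 1 - (y ^ 6) ^ v                                       ∎
    where open ≡-Reasoning
          H = geometric (y ^ 6) v
          solve-for : ∀ W H → (+ 1 - W * W) * H ≡ + 1 - (+ 1 + (W * W - + 1) * H)
          solve-for = solve-∀
          sixth : ∀ y → y * y * y * (y * y * y) ≡ y * y * y * y * y * y
          sixth = solve-∀

  -- With W = y³ of odd order 2v + 1 (W V ≈ 1 for V = W^{2v}), X inverts (1 + W)/2, and (1 + y) K = 1 + W.
  K-unit : ∀ {h} y v → (y ^ 6) ^ v * (y * y * y) ≈ + 1 → + 2 * h ≈ + 1 →
           let W = y * y * y
               V = (y ^ 6) ^ v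
               X = V * (+ 1 + W * (+ 1 - W) * geometric (y ^ 6) v)
           in (y * y - y + + 1) * (h * ((+ 1 + y) * X)) ≈ + 1
  K-unit {h} y v VW≈1 2h≈1 = begin
    (y * y - y + + 1) * (h * ((+ 1 + y) * X))      ≡⟨ cube y h X ⟩
    h * ((+ 1 + W) * X)                            ≡⟨ cong (h *_) (expand W V H) ⟩
    h * (V * (+ 1 + W) + V * W * ((+ 1 - W * W) * H))   ≡⟨ cong (λ x → h * (V * (+ 1 + W) + V * W * x)) (geometric-cube-squares y v) ⟩
    h * (V * (+ 1 + W) + V * W * (+ 1 - V))        ≡⟨ cong (h *_) (regroup V W) ⟩
    h * (V + + 2 * (V * W) - (V * W) * V)          ≈⟨ *-cong (≈-refl {h}) (+-cong (+-cong (≈-refl {V}) (*-cong (≈-refl {+ 2}) VW≈1)) (-‿cong (*-cong VW≈1 (≈-refl {V})))) ⟩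
    h * (V + + 2 * + 1 - + 1 * V)                  ≡⟨ cancel h V ⟩
    + 2 * h                                        ≈⟨ 2h≈1 ⟩
    + 1                                            ∎
    where
    open ≈-Reasoning
    W = y * y * y
    V = (y ^ 6) ^ v
    H = geometric (y ^ 6) v
    X = V * (+ 1 + W * (+ 1 - W) * H)
    cube : ∀ y h X → (y * y - y + + 1) * (h * ((+ 1 + y) * X)) ≡ h * ((+ 1 + y * y * y) * X)
    cube = solve-∀
    expand : ∀ W V H → (+ 1 + W) * (V * (+ 1 + W * (+ 1 - W) * H)) ≡ V * (+ 1 + W) + V * W * ((+ 1 - W * W) * H)
    expand = solve-∀
    regroup : ∀ V W → V * (+ 1 + W) + V * W * (+ 1 - V) ≡ V + + 2 * (V * W) - (V * W) * V
    regroup = solve-∀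
    cancel : ∀ h V → h * (V + + 2 * + 1 - + 1 * V) ≡ + 2 * h
    cancel = solve-∀

module NegatedResidues (m′ : Data.Nat.ℕ) where

  open import Data.Fin using (Fin; toℕ; fromℕ<)
  open import Data.Fin.Permutation using (Permutation; permutation)
  open import Data.Fin.Properties using (toℕ-injective; toℕ-fromℕ<; toℕ<n)
  open import Data.Integer using (ℤ; +_; _+_; _*_; -_; _%ℕ_)
  import Data.Integer.Properties as ℤ
  open import Data.Integer.DivMod using (n%ℕd<d)
  open import Data.Integer.Tactic.RingSolver using (solve-∀)
  open import Data.Nat as ℕ using (ℕ; suc; _<_)
  import Data.Nat.Properties as ℕ
  open import Data.Nat.Divisibility using (_∣_)
  open import Relation.Binary.PropositionalEquality

  m : ℕ
  m = suc m′

  open IntegersModulo m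

  neg-residue : ℕ → ℕ → ℕ
  neg-residue a j = (- (+ a * + j)) %ℕ m

  neg-residue<m : ∀ a j → neg-residue a j < m
  neg-residue<m a j = n%ℕd<d (- (+ a * + j)) m

  neg-residue-≈ : ∀ a j → + neg-residue a j ≈ - (+ a * + j)
  neg-residue-≈ a j = %ℕ-≈ (- (+ a * + j))

  neg-residue-involutive : ∀ {a b} → a ℕ.* b ≡ 1 [mod m ] → ∀ {j} → j < m →
                           neg-residue b (neg-residue a j) ≡ j
  neg-residue-involutive {a} {b} ab≡1 {j} j<m =
    ≈-residue (neg-residue<m b _) j<m (begin
      + neg-residue b (neg-residue a j)    ≈⟨ neg-residue-≈ b (neg-residue a j) ⟩
      - (+ b * + neg-residue a j)          ≈⟨ -‿cong (*-cong (≈-refl {+ b}) (neg-residue-≈ a j)) ⟩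
      - (+ b * - (+ a * + j))              ≡⟨ regroup (+ a) (+ b) (+ j) ⟩
      + a * + b * + j                      ≡⟨ cong (_* + j) (ℤ.pos-* a b) ⟨
      + (a ℕ.* b) * + j                    ≈⟨ *-cong (≡[mod]⇒≈ {a ℕ.* b} {1} ab≡1) (≈-refl {+ j}) ⟩
      + 1 * + j                            ≡⟨ ℤ.*-identityˡ (+ j) ⟩
      + j                                  ∎)
    where open ≈-Reasoning
          regroup : ∀ a b j → - (b * - (a * j)) ≡ a * b * j
          regroup = solve-∀

  negation-permutation : ∀ {a b} → a ℕ.* b ≡ 1 [mod m ] → Permutation m m
  negation-permutation {a} {b} ab≡1 = permutation (negate a) (negate b) (inverse {b} {a} ba≡1) (inverse {a} {b} ab≡1)
    where
    negate : ℕ → Fin m → Fin m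
    negate c j = fromℕ< (neg-residue<m c (toℕ j))
    ba≡1 : b ℕ.* a ≡ 1 [mod m ]
    ba≡1 = subst (λ x → x ≡ 1 [mod m ]) (ℕ.*-comm a b) ab≡1
    inverse : ∀ {c c′} → c ℕ.* c′ ≡ 1 [mod m ] → ∀ j → negate c′ (negate c j) ≡ j
    inverse {c} {c′} cc′≡1 j = toℕ-injective (begin
      toℕ (negate c′ (negate c j))                   ≡⟨ toℕ-fromℕ< _ ⟩
      neg-residue c′ (toℕ (negate c j))              ≡⟨ cong (neg-residue c′) (toℕ-fromℕ< _) ⟩
      neg-residue c′ (neg-residue c (toℕ j))         ≡⟨ neg-residue-involutive {c} {c′} cc′≡1 (toℕ<n j) ⟩
      toℕ j                                          ∎)
      where open ≡-Reasoning

  neg-residue-complement : ∀ a j → m ∣ neg-residue a j ℕ.+ a ℕ.* j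
  neg-residue-complement a j = subst (m ∣_) (ℕ.∣-∣-identityʳ _) (≈⇒≡[mod] (begin
    + (neg-residue a j ℕ.+ a ℕ.* j)        ≡⟨ ℤ.pos-+ (neg-residue a j) (a ℕ.* j) ⟩
    + neg-residue a j + + (a ℕ.* j)        ≈⟨ +-cong (neg-residue-≈ a j) (≡⇒≈ (ℤ.pos-* a j)) ⟩
    - (+ a * + j) + + a * + j              ≡⟨ ℤ.+-inverseˡ (+ a * + j) ⟩
    + 0                                    ∎))
    where open ≈-Reasoning

module MatrixSum (d′ m′ s e : Data.Nat.ℕ) (se≡1 : s Data.Nat.* e ≡ 1 [mod Data.Nat.suc m′ ]) where

  open import Algebra.Bundles using (CommutativeRing)
  open import Algebra.Properties.CommutativeSemigroup Data.Integer.Properties.*-commutativeSemigroup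
    using (x∙yz≈y∙xz)
  open import Data.Bool using (if_then_else_; true; false)
  open import Data.Bool.Properties using (T-≡)
  open import Data.Fin using (Fin; toℕ; inject₁; fromℕ)
  open import Data.Fin.Permutation using (Permutation; _⟨$⟩ʳ_; inverseˡ)
  open import Data.Fin.Properties using (toℕ<n; toℕ-inject₁; toℕ-fromℕ; toℕ-fromℕ<)
  open import Data.Integer using (ℤ; +_; _+_; _-_; _*_; _^_)
  import Data.Integer.Properties as ℤ
  open import Data.Integer.DivMod using (n%ℕd<d)
  open import Data.Integer.Tactic.RingSolver using (solve-∀)
  open import Data.List using (List; length)
  open import Data.Nat as ℕ using (ℕ; zero; suc; _<_; _≤_; _<ᵇ_)
  import Data.Nat.Properties as ℕ
  open import Data.Nat.Divisibility using (_∣_)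
  open import Data.Nat.ListAction using (sum)
  import Data.Nat.Tactic.RingSolver as ℕ-Solver
  open import Data.Product using (_×_; _,_; ∃; proj₁; proj₂)
  open import Function.Bundles using (Equivalence)
  open import Relation.Binary.PropositionalEquality
  open import Defs using (K; pow2; wt; nth; matSum; Σ<)
  open BinaryWeight using (binary-expansion; digits-<; wt-digits)
  open CoefficientLists using (ev; geometric; geometric-closed; geometric-as-sum; ev-as-sum; sum-as-∑; Bits; nth-bit)
  open FiniteSums

  m d n′ n r : ℕ
  m  = suc m′
  d  = suc d′
  n′ = m′ ℕ.+ d′ ℕ.* m
  n  = suc n′
  r  = d ℕ.* s

  open NegatedResidues m′ using (neg-residue; neg-residue<m; negation-permutation; neg-residue-complement)
  open IntegerCasts using (two; pos-^; K-cast)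
  open PowersOfTwo n′ using (2^n≈1; 2^[n*c]≈1; 2^a*2^b≈1)
  open PowersOfTwo n′ using (N) public
  open Scaling using (≈-scale)
  open IntegersModulo N
  module Mod-n = IntegersModulo n
  module Σmod = Algebra.Properties.Semiring.Sum (CommutativeRing.semiring ℤ/N)

  -- Since i - j r ≡ i + d σ j (mod n), the entry a_{i,j} becomes the bit 2^(position i j).
  σ : ℕ → ℕ
  σ = neg-residue s

  position : ℕ → ℕ → ℕ
  position i j = i ℕ.+ d ℕ.* σ j

  position<n : ∀ {i} j → i < d → position i j < n
  position<n {i} j i<d = begin-strict
    i ℕ.+ d ℕ.* σ j    <⟨ ℕ.+-monoˡ-< (d ℕ.* σ j) i<d ⟩
    d ℕ.+ d ℕ.* σ j    ≡⟨ ℕ.*-suc d (σ j) ⟨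
    d ℕ.* suc (σ j)    ≤⟨ ℕ.*-monoʳ-≤ d (neg-residue<m s j) ⟩
    d ℕ.* m            ∎
    where open ℕ.≤-Reasoning

  column-shift : ∀ j → ∃ λ c → d ℕ.* σ j ℕ.+ j ℕ.* r ≡ n ℕ.* c
  column-shift j = c , (begin
    d ℕ.* σ j ℕ.+ j ℕ.* (d ℕ.* s)    ≡⟨ factor d (σ j) j s ⟩
    d ℕ.* (σ j ℕ.+ s ℕ.* j)          ≡⟨ cong (d ℕ.*_) eq ⟩
    d ℕ.* (c ℕ.* m)                  ≡⟨ regroup d c m ⟩
    d ℕ.* m ℕ.* c                    ∎)
    where open ≡-Reasoning
          open _∣_ (neg-residue-complement s j) renaming (quotient to c; equality to eq)
          factor : ∀ d σ j s → d ℕ.* σ ℕ.+ j ℕ.* (d ℕ.* s) ≡ d ℕ.* (σ ℕ.+ s ℕ.* j)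
          factor = ℕ-Solver.solve-∀
          regroup : ∀ d c m → d ℕ.* (c ℕ.* m) ≡ d ℕ.* m ℕ.* c
          regroup = ℕ-Solver.solve-∀

  pow2-position : ∀ {i} j → i < d → pow2 n (+ i - + (j ℕ.* r)) ≡ 2 ℕ.^ position i j
  pow2-position {i} j i<d = cong (2 ℕ.^_) (Mod-n.≈-residue (n%ℕd<d x n) (position<n j i<d)
    (Mod-n.≈-trans (Mod-n.%ℕ-≈ x) (Mod-n.-≈+-complement i (d ℕ.* σ j) (j ℕ.* r) c eq)))
    where x = + i - + (j ℕ.* r)
          c = proj₁ (column-shift j)
          eq = proj₂ (column-shift j)

  row : List ℕ → List ℕ → Fin d → List ℕ
  row r₁ r₂ i = if toℕ i <ᵇ d′ then r₁ else r₂

  matSum-as-∑ : ∀ r₁ r₂ → matSum n r d m r₁ r₂ ≡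
    Σℕ.sum (λ (i : Fin d) → Σℕ.sum (λ (j : Fin m) → nth (row r₁ r₂ i) (toℕ j) ℕ.* 2 ℕ.^ position (toℕ i) (toℕ j)))
  matSum-as-∑ r₁ r₂ = trans (Σ<-as-∑ d (λ i → Σ< m (entry i))) (Σℕ.sum-cong-≗ {d} λ i → trans (Σ<-as-∑ m (entry (toℕ i)))
    (Σℕ.sum-cong-≗ {m} λ j → cong (nth (row r₁ r₂ i) (toℕ j) ℕ.*_) (pow2-position (toℕ j) (toℕ<n i))))
    where entry : ℕ → ℕ → ℕ
          entry i j = nth (if i <ᵇ d′ then r₁ else r₂) j ℕ.* pow2 n (+ i - + (j ℕ.* r))

  es≡1 : e ℕ.* s ≡ 1 [mod m ]
  es≡1 = subst (λ x → x ≡ 1 [mod m ]) (ℕ.*-comm s e) se≡1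

  π : Permutation m m
  π = negation-permutation {e} {s} es≡1

  σ-π : ∀ t → σ (toℕ (π ⟨$⟩ʳ t)) ≡ toℕ t
  σ-π t = trans (sym (toℕ-fromℕ< (neg-residue<m s (toℕ (π ⟨$⟩ʳ t))))) (cong toℕ (inverseˡ π))

  z : ℤ
  z = two ^ (n′ ℕ.* r)

  2^dσ≈z^j : ∀ j → two ^ (d ℕ.* σ j) ≈ z ^ j
  2^dσ≈z^j j = inverse-unique (2^a*2^b≈1 (d ℕ.* σ j) (j ℕ.* r) (proj₁ (column-shift j)) (proj₂ (column-shift j))) (begin
    z ^ j * two ^ (j ℕ.* r)              ≡⟨ cong (_* two ^ (j ℕ.* r)) (ℤ.^-*-assoc two (n′ ℕ.* r) j) ⟩
    two ^ (n′ ℕ.* r ℕ.* j) * two ^ (j ℕ.* r)  ≈⟨ 2^a*2^b≈1 (n′ ℕ.* r ℕ.* j) (j ℕ.* r) (r ℕ.* j) (collect n′ r j) ⟩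
    + 1                                  ∎)
    where open ≈-Reasoning
          collect : ∀ n′ r j → n′ ℕ.* r ℕ.* j ℕ.+ j ℕ.* r ≡ suc n′ ℕ.* (r ℕ.* j)
          collect = ℕ-Solver.solve-∀

  <ᵇ-irrefl : ∀ k → (k <ᵇ k) ≡ false
  <ᵇ-irrefl zero    = refl
  <ᵇ-irrefl (suc k) = <ᵇ-irrefl k

  y*z≈1 : two ^ r * z ≈ + 1
  y*z≈1 = 2^a*2^b≈1 r (n′ ℕ.* r) r refl

  z^m≈1 : z ^ m ≈ + 1
  z^m≈1 = ≈-trans (≡⇒≈ (trans (ℤ.^-*-assoc two (n′ ℕ.* r) m) (cong (two ^_) (regroup n′ d s m)))) (2^[n*c]≈1 (n′ ℕ.* s))
    where regroup : ∀ a d s m → a ℕ.* (d ℕ.* s) ℕ.* m ≡ d ℕ.* m ℕ.* (a ℕ.* s)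
          regroup = ℕ-Solver.solve-∀

  exponent-cast : + (d ℕ.+ n′ ℕ.* r ℕ.* e) ≡ + d + + n′ * (+ d * + (s ℕ.* e))
  exponent-cast = begin
    + (d ℕ.+ n′ ℕ.* (d ℕ.* s) ℕ.* e)         ≡⟨ cong (λ x → + (d ℕ.+ x)) (reassoc n′ d s e) ⟩
    + (d ℕ.+ n′ ℕ.* (d ℕ.* (s ℕ.* e)))       ≡⟨ ℤ.pos-+ d _ ⟩
    + d + + (n′ ℕ.* (d ℕ.* (s ℕ.* e)))       ≡⟨ cong (λ x → + d + x) (trans (ℤ.pos-* n′ _) (cong (+ n′ *_) (ℤ.pos-* d (s ℕ.* e)))) ⟩
    + d + + n′ * (+ d * + (s ℕ.* e))         ∎
    where open ≡-Reasoning
          reassoc : ∀ n′ d s e → n′ ℕ.* (d ℕ.* s) ℕ.* e ≡ n′ ℕ.* (d ℕ.* (s ℕ.* e))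
          reassoc = ℕ-Solver.solve-∀

  -- d + (n - 1) r e ≡ d (1 - s e) ≡ 0 modulo n = d m, as s e ≡ 1 modulo m.
  exponent-divisible : n ∣ d ℕ.+ n′ ℕ.* r ℕ.* e
  exponent-divisible = subst (n ∣_) (ℕ.∣-∣-identityʳ _) (Mod-n.≈⇒≡[mod] (begin
    + (d ℕ.+ n′ ℕ.* r ℕ.* e)                 ≡⟨ exponent-cast ⟩
    + d + + n′ * (+ d * + (s ℕ.* e))         ≈⟨ Mod-n.+-cong (Mod-n.≈-refl {+ d}) (Mod-n.*-cong (Mod-n.≈-refl {+ n′}) (≈-scale d (Mod-n′.≡[mod]⇒≈ {s ℕ.* e} {1} se≡1))) ⟩
    + d + + n′ * (+ d * + 1)                 ≡⟨ collect (+ d) (+ n′) ⟩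
    (+ 1 + + n′) * + d                       ≡⟨ cong (_* + d) (ℤ.pos-+ 1 n′) ⟨
    + n * + d                                ≈⟨ Mod-n.*-cong Mod-n.N≈0 (Mod-n.≈-refl {+ d}) ⟩
    + 0 * + d                                ≡⟨ ℤ.*-zeroˡ (+ d) ⟩
    + 0                                      ∎))
    where
    open Mod-n.≈-Reasoning
    module Mod-n′ = IntegersModulo m
    collect : ∀ d n′ → d + n′ * (d * + 1) ≡ (+ 1 + n′) * d
    collect = solve-∀

  2^d*z^e≈1 : two ^ d * z ^ e ≈ + 1
  2^d*z^e≈1 = ≈-trans (≡⇒≈ (cong (two ^ d *_) (ℤ.^-*-assoc two (n′ ℕ.* r) e)))
    (2^a*2^b≈1 d (n′ ℕ.* r ℕ.* e) c (trans equality (ℕ.*-comm c n)))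
    where open _∣_ exponent-divisible renaming (quotient to c)

  module Rows (r₁ r₂ : List ℕ) (bits₁ : Bits r₁) (bits₂ : Bits r₂) (len₁ : length r₁ ≡ m) (len₂ : length r₂ ≡ m) where

    a : Fin d → Fin m → ℕ
    a i j = nth (row r₁ r₂ i) (toℕ j)

    a-bit : ∀ i j → a i j ≤ 1
    a-bit i j with toℕ i <ᵇ d′
    ... | true  = nth-bit bits₁ (toℕ j)
    ... | false = nth-bit bits₂ (toℕ j)

    row-inject₁ : ∀ i → row r₁ r₂ (inject₁ i) ≡ r₁
    row-inject₁ i = cong (if_then r₁ else r₂)
      (trans (cong (_<ᵇ d′) (toℕ-inject₁ i)) (Equivalence.to T-≡ (ℕ.<⇒<ᵇ (toℕ<n i))))

    row-last : row r₁ r₂ (fromℕ d′) ≡ r₂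
    row-last = cong (if_then r₁ else r₂) (trans (cong (_<ᵇ d′) (toℕ-fromℕ d′)) (<ᵇ-irrefl d′))

    column-digit : Fin m → ℕ
    column-digit t = Σℕ.sum (λ i → a i (π ⟨$⟩ʳ t) ℕ.* 2 ℕ.^ toℕ i)

    matSum-base-2^d : matSum n r d m r₁ r₂ ≡ Σℕ.sum (λ t → column-digit t ℕ.* 2 ℕ.^ (d ℕ.* toℕ t))
    matSum-base-2^d = begin
      matSum n r d m r₁ r₂
        ≡⟨ matSum-as-∑ r₁ r₂ ⟩
      Σℕ.sum (λ i → Σℕ.sum (λ j → a i j ℕ.* 2 ℕ.^ position (toℕ i) (toℕ j)))
        ≡⟨ Σℕ.sum-cong-≗ {d} (λ i → trans (Σℕ.∑-permute (λ j → a i j ℕ.* 2 ℕ.^ position (toℕ i) (toℕ j)) π) (Σℕ.sum-cong-≗ {m} λ t → cong (λ x → a i (π ⟨$⟩ʳ t) ℕ.* 2 ℕ.^ (toℕ i ℕ.+ d ℕ.* x)) (σ-π t))) ⟩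
      Σℕ.sum (λ i → Σℕ.sum (λ t → a i (π ⟨$⟩ʳ t) ℕ.* 2 ℕ.^ (toℕ i ℕ.+ d ℕ.* toℕ t)))
        ≡⟨ Σℕ.∑-comm {d} {m} (λ i t → a i (π ⟨$⟩ʳ t) ℕ.* 2 ℕ.^ (toℕ i ℕ.+ d ℕ.* toℕ t)) ⟩
      Σℕ.sum (λ t → Σℕ.sum (λ i → a i (π ⟨$⟩ʳ t) ℕ.* 2 ℕ.^ (toℕ i ℕ.+ d ℕ.* toℕ t)))
        ≡⟨ Σℕ.sum-cong-≗ {m} (λ t → trans (Σℕ.sum-cong-≗ {d} λ i → split (a i (π ⟨$⟩ʳ t)) (toℕ i) (d ℕ.* toℕ t))
                                       (sym (Σℕ.*-distribʳ-sum {d} (2 ℕ.^ (d ℕ.* toℕ t)) (λ i → a i (π ⟨$⟩ʳ t) ℕ.* 2 ℕ.^ toℕ i)))) ⟩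
      Σℕ.sum (λ t → column-digit t ℕ.* 2 ℕ.^ (d ℕ.* toℕ t))
        ∎
      where open ≡-Reasoning
            split : ∀ c i k → c ℕ.* 2 ℕ.^ (i ℕ.+ k) ≡ c ℕ.* 2 ℕ.^ i ℕ.* 2 ℕ.^ k
            split c i k = trans (cong (c ℕ.*_) (ℕ.^-distribˡ-+-* 2 i k)) (sym (ℕ.*-assoc c _ _))

    column-digit-expansion : ∀ t → column-digit t < 2 ℕ.^ d × wt (column-digit t) ≡ Σℕ.sum (λ i → a i (π ⟨$⟩ʳ t))
    column-digit-expansion t = binary-expansion (λ i → a i (π ⟨$⟩ʳ t)) (λ i → a-bit i _)

    matSum<2^n : matSum n r d m r₁ r₂ < 2 ℕ.^ n
    matSum<2^n = subst (_< 2 ℕ.^ n) (sym matSum-base-2^d)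
      (digits-< d column-digit (λ t → proj₁ (column-digit-expansion t)))

    entries-sum : Σℕ.sum (λ i → Σℕ.sum (a i)) ≡ d′ ℕ.* sum r₁ ℕ.+ sum r₂
    entries-sum = begin
      Σℕ.sum (λ i → Σℕ.sum (a i))
        ≡⟨ Σℕ.sum-init-last {d′} (λ i → Σℕ.sum (a i)) ⟩
      Σℕ.sum (λ i → Σℕ.sum (a (inject₁ i))) ℕ.+ Σℕ.sum (a (fromℕ d′))
        ≡⟨ cong₂ ℕ._+_ (Σℕ.sum-cong-≗ {d′} λ i → cong (λ R → Σℕ.sum {m} (λ j → nth R (toℕ j))) (row-inject₁ i))
                       (cong (λ R → Σℕ.sum {m} (λ j → nth R (toℕ j))) row-last) ⟩
      Σℕ.sum {d′} (λ _ → Σℕ.sum {m} (λ j → nth r₁ (toℕ j))) ℕ.+ Σℕ.sum {m} (λ j → nth r₂ (toℕ j))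
        ≡⟨ cong₂ ℕ._+_ (trans (sum-const d′ (Σℕ.sum {m} (λ j → nth r₁ (toℕ j)))) (cong (d′ ℕ.*_) (sum-as-∑ r₁ len₁))) (sum-as-∑ r₂ len₂) ⟩
      d′ ℕ.* sum r₁ ℕ.+ sum r₂
        ∎
      where open ≡-Reasoning

    wt-matSum : wt (matSum n r d m r₁ r₂) ≡ d′ ℕ.* sum r₁ ℕ.+ sum r₂
    wt-matSum = begin
      wt (matSum n r d m r₁ r₂)                                 ≡⟨ cong wt matSum-base-2^d ⟩
      wt (Σℕ.sum (λ t → column-digit t ℕ.* 2 ℕ.^ (d ℕ.* toℕ t)))  ≡⟨ wt-digits d column-digit (λ t → proj₁ (column-digit-expansion t)) ⟩
      Σℕ.sum (λ t → wt (column-digit t))                        ≡⟨ Σℕ.sum-cong-≗ {m} (λ t → proj₂ (column-digit-expansion t)) ⟩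
      Σℕ.sum (λ t → Σℕ.sum (λ i → a i (π ⟨$⟩ʳ t)))              ≡⟨ Σℕ.∑-comm {d} {m} (λ i t → a i (π ⟨$⟩ʳ t)) ⟨
      Σℕ.sum (λ i → Σℕ.sum (λ t → a i (π ⟨$⟩ʳ t)))              ≡⟨ Σℕ.sum-cong-≗ {d} (λ i → Σℕ.∑-permute (a i) π) ⟨
      Σℕ.sum (λ i → Σℕ.sum (a i))                               ≡⟨ entries-sum ⟩
      d′ ℕ.* sum r₁ ℕ.+ sum r₂                                  ∎
      where open ≡-Reasoning

    term-≈ : ∀ c i j → + (c ℕ.* 2 ℕ.^ position i j) ≈ two ^ i * (+ c * z ^ j)
    term-≈ c i j = begin
      + (c ℕ.* 2 ℕ.^ (i ℕ.+ d ℕ.* σ j))          ≡⟨ trans (ℤ.pos-* c _) (cong (+ c *_) (pos-^ 2 (i ℕ.+ d ℕ.* σ j))) ⟩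
      + c * two ^ (i ℕ.+ d ℕ.* σ j)              ≡⟨ cong (+ c *_) (ℤ.^-distribˡ-+-* two i (d ℕ.* σ j)) ⟩
      + c * (two ^ i * two ^ (d ℕ.* σ j))        ≈⟨ *-cong (≈-refl {+ c}) (*-cong (≈-refl {two ^ i}) (2^dσ≈z^j j)) ⟩
      + c * (two ^ i * z ^ j)                    ≡⟨ x∙yz≈y∙xz (+ c) (two ^ i) (z ^ j) ⟩
      two ^ i * (+ c * z ^ j)                    ∎
      where open ≈-Reasoning

    geometric-two : ∀ k → geometric two k ≡ two ^ k - + 1
    geometric-two k = trans (solve-for-G (geometric two k)) (cong (_- + 1) (sym (geometric-closed two k)))
      where solve-for-G : ∀ G → G ≡ + 1 + (+ 2 - + 1) * G - + 1
            solve-for-G = solve-∀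

    matSum-≈ : + matSum n r d m r₁ r₂ ≈ (two ^ d′ - + 1) * ev z r₁ + two ^ d′ * ev z r₂
    matSum-≈ = begin
      + matSum n r d m r₁ r₂
        ≡⟨ cong +_ (matSum-as-∑ r₁ r₂) ⟩
      + Σℕ.sum (λ i → Σℕ.sum (λ j → a i j ℕ.* 2 ℕ.^ position (toℕ i) (toℕ j)))
        ≡⟨ trans (sum-cast {d} (λ i → Σℕ.sum (λ j → a i j ℕ.* 2 ℕ.^ position (toℕ i) (toℕ j))))
                 (Σℤ.sum-cong-≗ {d} λ i → sum-cast {m} (λ j → a i j ℕ.* 2 ℕ.^ position (toℕ i) (toℕ j))) ⟩
      Σℤ.sum (λ i → Σℤ.sum (λ j → + (a i j ℕ.* 2 ℕ.^ position (toℕ i) (toℕ j))))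
        ≈⟨ Σmod.sum-cong-≋ {d} (λ i → Σmod.sum-cong-≋ {m} (λ j → term-≈ (a i j) (toℕ i) (toℕ j))) ⟩
      Σℤ.sum (λ i → Σℤ.sum (λ j → two ^ toℕ i * (+ a i j * z ^ toℕ j)))
        ≡⟨ Σℤ.sum-cong-≗ {d} (λ i → sym (Σℤ.*-distribˡ-sum {m} (two ^ toℕ i) (λ j → + a i j * z ^ toℕ j))) ⟩
      Σℤ.sum (λ i → two ^ toℕ i * Σℤ.sum (λ j → + a i j * z ^ toℕ j))
        ≡⟨ Σℤ.sum-init-last {d′} (λ i → two ^ toℕ i * Σℤ.sum (λ j → + a i j * z ^ toℕ j)) ⟩
      Σℤ.sum (λ i → two ^ toℕ (inject₁ i) * Σℤ.sum (λ j → + a (inject₁ i) j * z ^ toℕ j))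
        + two ^ toℕ (fromℕ d′) * Σℤ.sum (λ j → + a (fromℕ d′) j * z ^ toℕ j)
        ≡⟨ cong₂ _+_ (Σℤ.sum-cong-≗ {d′} λ i → cong₂ (λ k R → two ^ k * evaluation R) (toℕ-inject₁ i) (row-inject₁ i))
                     (cong₂ (λ k R → two ^ k * evaluation R) (toℕ-fromℕ d′) row-last) ⟩
      Σℤ.sum {d′} (λ i → two ^ toℕ i * evaluation r₁) + two ^ d′ * evaluation r₂
        ≡⟨ cong₂ (λ x y → Σℤ.sum {d′} (λ i → two ^ toℕ i * x) + two ^ d′ * y) (ev-as-sum z r₁ len₁) (ev-as-sum z r₂ len₂) ⟩
      Σℤ.sum {d′} (λ i → two ^ toℕ i * ev z r₁) + two ^ d′ * ev z r₂
        ≡⟨ cong (_+ two ^ d′ * ev z r₂) (trans (sym (Σℤ.*-distribʳ-sum {d′} (ev z r₁) (λ i → two ^ toℕ i)))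
                                               (cong (_* ev z r₁) (trans (geometric-as-sum two d′) (geometric-two d′)))) ⟩
      (two ^ d′ - + 1) * ev z r₁ + two ^ d′ * ev z r₂
        ∎
      where open ≈-Reasoning
            evaluation : List ℕ → ℤ
            evaluation R = Σℤ.sum {m} (λ j → + nth R (toℕ j) * z ^ toℕ j)


    K*matSum≡1 : ∀ {A₁ A₂ t c T₁ T₂} → ev z r₁ ≡ A₁ → ev z r₂ ≡ A₂ → z ^ e ≡ t → c * t ≡ z ^ m →
      A₁ + A₂ ≈ T₁ + t * T₂ → (+ 1 - z + z * z) * (T₂ + c * T₁ - + 2 * A₁) ≈ + 2 * z * z →
      K r ℕ.* matSum n r d m r₁ r₂ ≡ 1 [mod N ]
    K*matSum≡1 {c = c} {T₁} {T₂} refl refl refl ct≡z^m sum≈ D≈ = ≈⇒≡[mod] (begin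
      + (K r ℕ.* matSum n r d m r₁ r₂)                                 ≡⟨ ℤ.pos-* (K r) _ ⟩
      + K r * + matSum n r d m r₁ r₂                                   ≡⟨ cong (_* + matSum n r d m r₁ r₂) (K-cast r) ⟩
      (y * y - y + + 1) * + matSum n r d m r₁ r₂                       ≈⟨ *-cong (≈-refl {y * y - y + + 1}) matSum-≈ ⟩
      (y * y - y + + 1) * ((two ^ d′ - + 1) * ev z r₁ + two ^ d′ * ev z r₂)
        ≈⟨ K-inverse {two ^ r} {z} {two ^ n′} {two ^ d′} {z ^ e} {c} {ev z r₁} {ev z r₂} {T₁} {T₂}
             y*z≈1 2^n≈1 2^d*z^e≈1 (≈-trans (≡⇒≈ ct≡z^m) z^m≈1) sum≈ D≈ ⟩
      + 1                                                              ∎)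
      where open ≈-Reasoning
            y = two ^ r

module Arithmetic where
  open import Data.Empty using (⊥-elim)
  open import Data.Nat
  open import Data.Nat.Properties
  open import Data.Nat.DivMod using (m*n/n≡m; [m+kn]%n≡m%n; m<n⇒m%n≡m; m≡m%n+[m/n]*n)
  open import Data.Nat.Divisibility using (_∣_; _∣0; ∣1⇒≡1)
  import Data.Nat.Tactic.RingSolver as ℕ-Solver
  open import Data.Product using (∃₂; _×_; _,_)
  open import Relation.Binary.PropositionalEquality
  open import Defs using (wt)

  blocks-of-6 : ∀ p c → (6 * p + c ∸ c) / 6 ≡ p
  blocks-of-6 p c = trans (cong (_/ 6) (trans (m+n∸n≡m (6 * p) c) (*-comm 6 p))) (m*n/n≡m p 6)

  residue-split : ∀ e c → e % 6 ≡ c → e ≡ 6 * (e / 6) + c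
  residue-split e c e%6≡c = trans (m≡m%n+[m/n]*n e 6) (trans (cong (_+ (e / 6) * 6) e%6≡c) (swap c (e / 6)))
    where swap : ∀ c k → c + k * 6 ≡ 6 * k + c
          swap = ℕ-Solver.solve-∀

  residue-1-split : ∀ {v e} → e % 6 ≡ 1 → e ≤ 3 + 6 * v → ∃₂ λ p k → v ≡ p + k × e ≡ 6 * k + 1
  residue-1-split {v} {e} e%6≡1 e≤m = v ∸ k , k , sym (m∸n+n≡m k≤v) , e≡
    where
    k = e / 6
    e≡ : e ≡ 6 * k + 1
    e≡ = residue-split e 1 e%6≡1
    k≤v : k ≤ v
    k≤v = ≤-pred (*-cancelˡ-< 6 k (suc v) (begin-strict
      6 * k          <⟨ m<m+n (6 * k) (s≤s z≤n) ⟩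
      6 * k + 1      ≡⟨ e≡ ⟨
      e              ≤⟨ e≤m ⟩
      3 + 6 * v      <⟨ +-monoˡ-< (6 * v) {3} {6} (s≤s (s≤s (s≤s (s≤s z≤n)))) ⟩
      6 + 6 * v      ≡⟨ *-suc 6 v ⟨
      6 * suc v      ∎))
      where open ≤-Reasoning

  residue-5-split : ∀ {v e} → e % 6 ≡ 5 → e ≤ 3 + 6 * v → ∃₂ λ q k → v ≡ suc q + k × e ≡ 6 * k + 5
  residue-5-split {v} {e} e%6≡5 e≤m = v ∸ suc k , k , sym (trans (sym (+-suc (v ∸ suc k) k)) (m∸n+n≡m k<v)) , e≡
    where
    k = e / 6
    e≡ : e ≡ 6 * k + 5
    e≡ = residue-split e 5 e%6≡5
    k<v : suc k ≤ v
    k<v = ≤-pred (*-cancelˡ-< 6 (suc k) (suc v) (begin-strict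
      6 * suc k        ≡⟨ *-suc 6 k ⟩
      6 + 6 * k        ≡⟨ +-comm 6 (6 * k) ⟩
      6 * k + 6        ≡⟨ +-suc (6 * k) 5 ⟩
      suc (6 * k + 5)  ≡⟨ cong suc e≡ ⟨
      suc e            ≤⟨ s≤s e≤m ⟩
      4 + 6 * v        <⟨ +-monoˡ-< (6 * v) {4} {6} (s≤s (s≤s (s≤s (s≤s (s≤s z≤n))))) ⟩
      6 + 6 * v        ≡⟨ *-suc 6 v ⟨
      6 * suc v        ∎))
      where open ≤-Reasoning

  [6k+c]%6 : ∀ k c → c < 6 → (6 * k + c) % 6 ≡ c
  [6k+c]%6 k c c<6 = trans (cong (_% 6) (trans (+-comm (6 * k) c) (cong (c +_) (*-comm 6 k))))
                           (trans ([m+kn]%n≡m%n c k 6) (m<n⇒m%n≡m c<6))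

  6k+c-injective : ∀ {a b} c → 6 * a + c ≡ 6 * b + c → a ≡ b
  6k+c-injective {a} {b} c eq = *-cancelˡ-≡ a b 6 (+-cancelʳ-≡ c (6 * a) (6 * b) eq)

  6k+1≢6k+5 : ∀ a b → 6 * a + 1 ≢ 6 * b + 5
  6k+1≢6k+5 a b eq with trans (sym ([6k+c]%6 a 1 (s≤s (s≤s z≤n)))) (trans (cong (_% 6) eq) ([6k+c]%6 b 5 ≤-refl))
  ... | ()

  weight-formula : ∀ d′ v → d′ * (3 * v) + (3 * v + 2) ≡ (suc d′ * (3 + 6 * v) + 4 ∸ 3 * suc d′) / 2
  weight-formula d′ v = sym (begin
    (suc d′ * (3 + 6 * v) + 4 ∸ 3 * suc d′) / 2     ≡⟨ cong (λ x → (x ∸ 3 * suc d′) / 2) (split d′ v) ⟩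
    (3 * suc d′ + W * 2 ∸ 3 * suc d′) / 2            ≡⟨ cong (_/ 2) (m+n∸m≡n (3 * suc d′) (W * 2)) ⟩
    W * 2 / 2                                        ≡⟨ m*n/n≡m W 2 ⟩
    W                                                ∎)
    where open ≡-Reasoning
          W = d′ * (3 * v) + (3 * v + 2)
          split : ∀ d′ v → suc d′ * (3 + 6 * v) + 4 ≡ 3 * suc d′ + (d′ * (3 * v) + (3 * v + 2)) * 2
          split = ℕ-Solver.solve-∀

  weight-positive : ∀ d′ v → 0 < (suc d′ * (3 + 6 * v) + 4 ∸ 3 * suc d′) / 2
  weight-positive d′ v = subst (0 <_) (weight-formula d′ v)
    (≤-trans (s≤s z≤n) (≤-trans (m≤n+m 2 (3 * v)) (m≤n+m (3 * v + 2) (d′ * (3 * v)))))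

  wt-positive : ∀ {x w} → wt x ≡ w → 0 < w → 0 < x
  wt-positive {zero}  refl ()
  wt-positive {suc x} _    _ = s≤s z≤n

  <2^n⇒≤2^n∸1 : ∀ {x n} → x < 2 ^ n → x ≤ 2 ^ n ∸ 1
  <2^n⇒≤2^n∸1 {x} {n} x<2^n = subst (x ≤_) (sym (n∸1≡pred (2 ^ n))) (<⇒≤pred x<2^n)
    where n∸1≡pred : ∀ n → n ∸ 1 ≡ pred n
          n∸1≡pred zero    = refl
          n∸1≡pred (suc n) = refl

  ≡[mod]-refl : ∀ M x → x ≡ x [mod M ]
  ≡[mod]-refl M x = subst (M ∣_) (sym (∣n-n∣≡0 x)) (M ∣0)

  inverse-positive : ∀ {M a x} → 1 < M → a * x ≡ 1 [mod M ] → 0 < x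
  inverse-positive {M} {a} {zero}  1<M a0≡1 =
    ⊥-elim (<-irrefl (sym (∣1⇒≡1 (subst (λ y → y ≡ 1 [mod M ]) (*-zeroʳ a) a0≡1))) 1<M)
  inverse-positive {x = suc x} _ _ = s≤s z≤n

module CaseA (d′ p k s : Data.Nat.ℕ) (se≡1 : s Data.Nat.* (6 Data.Nat.* k Data.Nat.+ 1) ≡ 1 [mod 3 Data.Nat.+ 6 Data.Nat.* (p Data.Nat.+ k) ]) where

  open import Data.Integer using (ℤ; +_; _+_; _-_; -_; _*_; _^_)
  import Data.Integer.Properties as ℤ
  open import Data.Integer.Tactic.RingSolver using (solve-∀)
  open import Data.List using (List; []; _∷_; _++_; length)
  open import Data.List.Properties using (length-++; ++-assoc)
  open import Data.List.Relation.Unary.All.Properties using (++⁺)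
  open import Data.Nat as ℕ using (ℕ; _<_)
  import Data.Nat.Properties as ℕ
  open import Data.Nat.ListAction using (sum)
  open import Data.Nat.ListAction.Properties using (sum-++)
  import Data.Nat.Tactic.RingSolver as ℕ-Solver
  open import Data.Product using (_×_; _,_)
  open import Relation.Binary.PropositionalEquality
  open import Defs using (K; wt; matSum; rep; x₁; x₂; x₃; x₄; a₁-A; a₂-A)
  open CoefficientLists
  open Arithmetic

  v e : ℕ
  v = p ℕ.+ k
  e = 6 ℕ.* k ℕ.+ 1

  open MatrixSum d′ (2 ℕ.+ 6 ℕ.* v) s e se≡1

  m≡ : m ≡ (6 ℕ.* p ℕ.+ 2) ℕ.+ e
  m≡ = split p k
    where split : ∀ p k → 3 ℕ.+ 6 ℕ.* (p ℕ.+ k) ≡ (6 ℕ.* p ℕ.+ 2) ℕ.+ (6 ℕ.* k ℕ.+ 1)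
          split = ℕ-Solver.solve-∀

  m∸e : m ℕ.∸ e ≡ 6 ℕ.* p ℕ.+ 2
  m∸e = trans (cong (ℕ._∸ e) m≡) (ℕ.m+n∸n≡m (6 ℕ.* p ℕ.+ 2) e)

  row₁ row₂ : List ℕ
  row₁ = 0 ∷ 0 ∷ rep p x₁ ++ rep k x₂ ++ 0 ∷ []
  row₂ = 1 ∷ rep p (x₃ 6) ++ 1 ∷ 0 ∷ rep k x₄

  a₁-A≡row₁ : a₁-A m e k ≡ row₁
  a₁-A≡row₁ = cong (λ q → 0 ∷ 0 ∷ rep q x₁ ++ rep k x₂ ++ 0 ∷ [])
    (trans (cong (λ x → (x ℕ.∸ 2) ℕ./ 6) m∸e) (blocks-of-6 p 2))

  a₂-A≡row₂ : a₂-A m e k ≡ row₂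
  a₂-A≡row₂ = cong (1 ∷_) (begin
    x₃ (m ℕ.∸ e) ++ rep k x₄                     ≡⟨ cong (λ L → x₃ L ++ rep k x₄) m∸e ⟩
    x₃ (6 ℕ.* p ℕ.+ 2) ++ rep k x₄               ≡⟨ cong (_++ rep k x₄) (x₃-period p 2) ⟩
    (rep p (x₃ 6) ++ 1 ∷ 0 ∷ []) ++ rep k x₄     ≡⟨ ++-assoc (rep p (x₃ 6)) (1 ∷ 0 ∷ []) (rep k x₄) ⟩
    rep p (x₃ 6) ++ 1 ∷ 0 ∷ rep k x₄             ∎)
    where open ≡-Reasoning

  row₁-bits : Bits row₁
  row₁-bits = ++⁺ (bits-of (0 ∷ 0 ∷ [])) (++⁺ (rep-bits p (bits-of x₁)) (++⁺ (rep-bits k (bits-of x₂)) (bits-of (0 ∷ []))))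

  row₂-bits : Bits row₂
  row₂-bits = ++⁺ (bits-of (1 ∷ [])) (++⁺ (rep-bits p (bits-of (x₃ 6))) (++⁺ (bits-of (1 ∷ 0 ∷ [])) (rep-bits k (bits-of x₄))))

  length-row₁ : length row₁ ≡ m
  length-row₁ = trans (cong (2 ℕ.+_) (trans (length-++ (rep p x₁))
                  (cong₂ ℕ._+_ (length-rep p x₁) (trans (length-++ (rep k x₂)) (cong (ℕ._+ 1) (length-rep k x₂))))))
                (count p k)
    where count : ∀ p k → 2 ℕ.+ (p ℕ.* 6 ℕ.+ (k ℕ.* 6 ℕ.+ 1)) ≡ 3 ℕ.+ 6 ℕ.* (p ℕ.+ k)
          count = ℕ-Solver.solve-∀

  length-row₂ : length row₂ ≡ m
  length-row₂ = trans (cong ℕ.suc (trans (length-++ (rep p (x₃ 6))) (cong₂ ℕ._+_ (length-rep p (x₃ 6)) (cong (2 ℕ.+_) (length-rep k x₄)))))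
                (count p k)
    where count : ∀ p k → ℕ.suc (p ℕ.* 6 ℕ.+ (2 ℕ.+ k ℕ.* 6)) ≡ 3 ℕ.+ 6 ℕ.* (p ℕ.+ k)
          count = ℕ-Solver.solve-∀

  sum-row₁ : sum row₁ ≡ 3 ℕ.* v
  sum-row₁ = trans (trans (sum-++ (rep p x₁) _) (cong₂ ℕ._+_ (sum-rep p x₁) (trans (sum-++ (rep k x₂) _) (cong (ℕ._+ 0) (sum-rep k x₂)))))
                   (count p k)
    where count : ∀ p k → p ℕ.* 3 ℕ.+ (k ℕ.* 3 ℕ.+ 0) ≡ 3 ℕ.* (p ℕ.+ k)
          count = ℕ-Solver.solve-∀

  sum-row₂ : sum row₂ ≡ 3 ℕ.* v ℕ.+ 2
  sum-row₂ = trans (cong ℕ.suc (trans (sum-++ (rep p (x₃ 6)) _) (cong₂ ℕ._+_ (sum-rep p (x₃ 6)) (cong ℕ.suc (sum-rep k x₄)))))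
                   (count p k)
    where count : ∀ p k → ℕ.suc (p ℕ.* 3 ℕ.+ ℕ.suc (k ℕ.* 3)) ≡ 3 ℕ.* (p ℕ.+ k) ℕ.+ 2
          count = ℕ-Solver.solve-∀

  g h P Q c : ℤ
  g = geometric (z ^ 6) p
  h = geometric (z ^ 6) k
  P = (z ^ 6) ^ p
  Q = (z ^ 6) ^ k
  c = + 1 + z + z * z

  ev-row₁ : ev z row₁ ≡ + 0 + z * (+ 0 + z * (z * z * c * g + P * (z * z * z * c * h + Q * (+ 0 + z * + 0))))
  ev-row₁ = begin
    ev z row₁
      ≡⟨ cong (λ x → + 0 + z * (+ 0 + z * x)) (trans (ev-rep-++ z p x₁ _) (cong (λ x → ev z x₁ * g + P * x) (ev-rep-++ z k x₂ (0 ∷ [])))) ⟩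
    + 0 + z * (+ 0 + z * (ev z x₁ * g + P * (ev z x₂ * h + Q * (+ 0 + z * + 0))))
      ≡⟨ cong₂ (λ b₁ b₂ → + 0 + z * (+ 0 + z * (b₁ * g + P * (b₂ * h + Q * (+ 0 + z * + 0))))) (ev-x₁ z) (ev-x₂ z) ⟩
    + 0 + z * (+ 0 + z * (z * z * c * g + P * (z * z * z * c * h + Q * (+ 0 + z * + 0))))
      ∎
    where open ≡-Reasoning

  ev-row₂ : ev z row₂ ≡ + 1 + z * ((+ 1 + z * z + z * z * z * z) * g + P * (+ 1 + z * (+ 0 + z * (c * h))))
  ev-row₂ = begin
    ev z row₂
      ≡⟨ cong (λ x → + 1 + z * x) (trans (ev-rep-++ z p (x₃ 6) _) (cong (λ x → ev z (x₃ 6) * g + P * (+ 1 + z * (+ 0 + z * x))) (ev-rep z k x₄))) ⟩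
    + 1 + z * (ev z (x₃ 6) * g + P * (+ 1 + z * (+ 0 + z * (ev z x₄ * h))))
      ≡⟨ cong₂ (λ b₃ b₄ → + 1 + z * (b₃ * g + P * (+ 1 + z * (+ 0 + z * (b₄ * h))))) (ev-x₃ z) (ev-x₄ z) ⟩
    + 1 + z * ((+ 1 + z * z + z * z * z * z) * g + P * (+ 1 + z * (+ 0 + z * (c * h))))
      ∎
    where open ≡-Reasoning

  z^e≡zQ : z ^ e ≡ z * Q
  z^e≡zQ = trans (z^[6q+a] z k 1) (swap Q z)
    where swap : ∀ Q z → Q * (z * + 1) ≡ z * Q
          swap = solve-∀

  z^m≡z³PQ : z ^ m ≡ z * z * z * P * Q
  z^m≡z³PQ = begin
    z ^ m                                  ≡⟨ cong (z ^_) (split p k) ⟩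
    z ^ (6 ℕ.* p ℕ.+ (6 ℕ.* k ℕ.+ 3))      ≡⟨ z^[6q+a] z p _ ⟩
    P * z ^ (6 ℕ.* k ℕ.+ 3)                ≡⟨ cong (P *_) (z^[6q+a] z k 3) ⟩
    P * (Q * z ^ 3)                        ≡⟨ regroup z P Q ⟩
    z * z * z * P * Q                      ∎
    where open ≡-Reasoning
          split : ∀ p k → 3 ℕ.+ 6 ℕ.* (p ℕ.+ k) ≡ 6 ℕ.* p ℕ.+ (6 ℕ.* k ℕ.+ 3)
          split = ℕ-Solver.solve-∀
          regroup : ∀ z P Q → P * (Q * (z * (z * (z * + 1)))) ≡ z * z * z * P * Q
          regroup = solve-∀

  -- The last three factors in both certificates vanish: (ω - 1) g = P - 1 and (ω - 1) h = Q - 1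
  -- sum the geometric series, g + P h and h + Q g are both the geometric sum up to p + k,
  -- and z³ P Q = z^m ≈ 1.
  sum-certificate : ∀ z P Q g h →
    let c = + 1 + z + z * z
        ω = z * z * z * z * z * z
        A₁ = + 0 + z * (+ 0 + z * (z * z * c * g + P * (z * z * z * c * h + Q * (+ 0 + z * + 0))))
        A₂ = + 1 + z * ((+ 1 + z * z + z * z * z * z) * g + P * (+ 1 + z * (+ 0 + z * (c * h))))
        T₁ = (+ 1 + z + z * z * z + z * z * z * z + + 2 * z * z * z * z * z) * h + Q
        T₂ = (+ 1 + z * z + z * z * z + + 2 * z * z * z * z + z * z * z * z * z) * g + P
    in A₁ + A₂ ≡ T₁ + z * Q * T₂
                 + (+ 1 - Q) * ((ω - + 1) * g - (P - + 1))
                 + (P + z * P) * ((ω - + 1) * h - (Q - + 1))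
                 + (+ 1 + z + z * z * z + z * z * z * z + + 2 * z * z * z * z * z) * ((g + P * h) - (h + Q * g))
  sum-certificate = solve-∀

  D-certificate : ∀ z P Q g h →
    let c = + 1 + z + z * z
        ω = z * z * z * z * z * z
        A₁ = + 0 + z * (+ 0 + z * (z * z * c * g + P * (z * z * z * c * h + Q * (+ 0 + z * + 0))))
        T₁ = (+ 1 + z + z * z * z + z * z * z * z + + 2 * z * z * z * z * z) * h + Q
        T₂ = (+ 1 + z * z + z * z * z + + 2 * z * z * z * z + z * z * z * z * z) * g + P
    in (+ 1 - z + z * z) * (T₂ + z * z * P * T₁ - + 2 * A₁) ≡ + 2 * z * z
                 + (- + 1 + z - + 2 * z * z) * ((ω - + 1) * g - (P - + 1))
                 + (- (z * z * P)) * ((ω - + 1) * h - (Q - + 1))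
                 + (- + 1 + z) * (z * z * z * P * Q - + 1)
  D-certificate = solve-∀

  geometric-relation′ : ∀ q → (z * z * z * z * z * z - + 1) * geometric (z ^ 6) q - ((z ^ 6) ^ q - + 1) ≡ + 0
  geometric-relation′ q = trans (cong (λ ω → (ω - + 1) * geometric (z ^ 6) q - ((z ^ 6) ^ q - + 1)) (sym (z⁶ z)))
                                (geometric-relation (z ^ 6) q)

  T₁ T₂ : ℤ
  T₁ = (+ 1 + z + z * z * z + z * z * z * z + + 2 * z * z * z * z * z) * h + Q
  T₂ = (+ 1 + z * z + z * z * z + + 2 * z * z * z * z + z * z * z * z * z) * g + P

  c*t≡z^m : z * z * P * (z * Q) ≡ z ^ m
  c*t≡z^m = trans (regroup z P Q) (sym z^m≡z³PQ)
    where regroup : ∀ z P Q → z * z * P * (z * Q) ≡ z * z * z * P * Q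
          regroup = solve-∀

  caseA : (matSum n r d m (a₁-A m e k) (a₂-A m e k) < 2 ℕ.^ n)
        × (wt (matSum n r d m (a₁-A m e k) (a₂-A m e k)) ≡ (n ℕ.+ 4 ℕ.∸ 3 ℕ.* d) ℕ./ 2)
        × (K r ℕ.* matSum n r d m (a₁-A m e k) (a₂-A m e k) ≡ 1 [mod N ])
  caseA rewrite a₁-A≡row₁ | a₂-A≡row₂ =
    matSum<2^n ,
    trans wt-matSum (trans (cong₂ (λ a b → d′ ℕ.* a ℕ.+ b) sum-row₁ sum-row₂) (weight-formula d′ v)) ,
    K*matSum≡1 {t = z * Q} {c = z * z * P} {T₁ = T₁} {T₂ = T₂} ev-row₁ ev-row₂ z^e≡zQ c*t≡z^m
      (≈-by-certificate (+ 1 - Q) (P + z * P) (+ 1 + z + z * z * z + z * z * z * z + + 2 * z * z * z * z * z) (sum-certificate z P Q g h) (≡⇒≈ (geometric-relation′ p)) (≡⇒≈ (geometric-relation′ k))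
         (≡⇒≈ (trans (cong₂ _-_ (geometric-swap (z ^ 6) p k) refl) (ℤ.+-inverseʳ (h + Q * g)))))
      (≈-by-certificate (- + 1 + z - + 2 * z * z) (- (z * z * P)) (- + 1 + z) (D-certificate z P Q g h) (≡⇒≈ (geometric-relation′ p)) (≡⇒≈ (geometric-relation′ k))
         (≈-difference (≈-trans (≡⇒≈ (sym z^m≡z³PQ)) z^m≈1)))
    where open Rows row₁ row₂ row₁-bits row₂-bits length-row₁ length-row₂ using (matSum<2^n; wt-matSum; K*matSum≡1)
          open IntegersModulo N

module CaseB (d′ q k s : Data.Nat.ℕ) (se≡1 : s Data.Nat.* (6 Data.Nat.* k Data.Nat.+ 5) ≡ 1 [mod 3 Data.Nat.+ 6 Data.Nat.* (Data.Nat.suc q Data.Nat.+ k) ]) where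

  open import Data.Integer using (ℤ; +_; _+_; _-_; -_; _*_; _^_)
  import Data.Integer.Properties as ℤ
  open import Data.Integer.Tactic.RingSolver using (solve-∀)
  open import Data.List using (List; []; _∷_; _++_; length)
  open import Data.List.Properties using (length-++; ++-assoc)
  open import Data.List.Relation.Unary.All.Properties using (++⁺)
  open import Data.Nat as ℕ using (ℕ; _<_)
  import Data.Nat.Properties as ℕ
  open import Data.Nat.ListAction using (sum)
  open import Data.Nat.ListAction.Properties using (sum-++)
  import Data.Nat.Tactic.RingSolver as ℕ-Solver
  open import Data.Product using (_×_; _,_)
  open import Relation.Binary.PropositionalEquality
  open import Defs using (K; wt; matSum; rep; x₂; x₄; x₅; x₆; a₁-B; a₂-B)
  open CoefficientLists
  open Arithmetic

  v e : ℕ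
  v = ℕ.suc q ℕ.+ k
  e = 6 ℕ.* k ℕ.+ 5

  open MatrixSum d′ (2 ℕ.+ 6 ℕ.* v) s e se≡1

  m∸e : m ℕ.∸ e ≡ 6 ℕ.* q ℕ.+ 4
  m∸e = trans (cong (ℕ._∸ e) (split q k)) (ℕ.m+n∸n≡m (6 ℕ.* q ℕ.+ 4) e)
    where split : ∀ q k → 3 ℕ.+ 6 ℕ.* (ℕ.suc q ℕ.+ k) ≡ (6 ℕ.* q ℕ.+ 4) ℕ.+ (6 ℕ.* k ℕ.+ 5)
          split = ℕ-Solver.solve-∀

  row₁ row₂ : List ℕ
  row₁ = 0 ∷ 1 ∷ 0 ∷ 0 ∷ 0 ∷ rep q x₄ ++ 1 ∷ 1 ∷ 0 ∷ 0 ∷ rep k x₆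
  row₂ = 0 ∷ rep q (x₅ 6) ++ x₅ 6 ++ 1 ∷ 1 ∷ rep k x₂

  a₁-B≡row₁ : a₁-B m e k ≡ row₁
  a₁-B≡row₁ = cong (λ j → 0 ∷ 1 ∷ 0 ∷ 0 ∷ 0 ∷ rep j x₄ ++ 1 ∷ 1 ∷ 0 ∷ 0 ∷ rep k x₆)
    (trans (cong (λ x → (x ℕ.∸ 4) ℕ./ 6) m∸e) (blocks-of-6 q 4))

  a₂-B≡row₂ : a₂-B m e k ≡ row₂
  a₂-B≡row₂ = cong (0 ∷_) (begin
    x₅ (m ℕ.∸ e ℕ.+ 2) ++ 1 ∷ 1 ∷ rep k x₂             ≡⟨ cong (λ L → x₅ L ++ 1 ∷ 1 ∷ rep k x₂) (trans (cong (ℕ._+ 2) m∸e) (ℕ.+-assoc (6 ℕ.* q) 4 2)) ⟩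
    x₅ (6 ℕ.* q ℕ.+ 6) ++ 1 ∷ 1 ∷ rep k x₂             ≡⟨ cong (_++ 1 ∷ 1 ∷ rep k x₂) (x₅-period q 6) ⟩
    (rep q (x₅ 6) ++ x₅ 6) ++ 1 ∷ 1 ∷ rep k x₂         ≡⟨ ++-assoc (rep q (x₅ 6)) (x₅ 6) (1 ∷ 1 ∷ rep k x₂) ⟩
    rep q (x₅ 6) ++ x₅ 6 ++ 1 ∷ 1 ∷ rep k x₂           ∎)
    where open ≡-Reasoning

  row₁-bits : Bits row₁
  row₁-bits = ++⁺ (bits-of (0 ∷ 1 ∷ 0 ∷ 0 ∷ 0 ∷ [])) (++⁺ (rep-bits q (bits-of x₄)) (++⁺ (bits-of (1 ∷ 1 ∷ 0 ∷ 0 ∷ [])) (rep-bits k (bits-of x₆))))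

  row₂-bits : Bits row₂
  row₂-bits = ++⁺ (bits-of (0 ∷ [])) (++⁺ (rep-bits q (bits-of (x₅ 6))) (++⁺ (bits-of (x₅ 6 ++ 1 ∷ 1 ∷ [])) (rep-bits k (bits-of x₂))))

  length-row₁ : length row₁ ≡ m
  length-row₁ = trans (cong (5 ℕ.+_) (trans (length-++ (rep q x₄)) (cong₂ ℕ._+_ (length-rep q x₄) (cong (4 ℕ.+_) (length-rep k x₆)))))
                (count q k)
    where count : ∀ q k → 5 ℕ.+ (q ℕ.* 6 ℕ.+ (4 ℕ.+ k ℕ.* 6)) ≡ 3 ℕ.+ 6 ℕ.* (ℕ.suc q ℕ.+ k)
          count = ℕ-Solver.solve-∀

  length-row₂ : length row₂ ≡ m
  length-row₂ = trans (cong ℕ.suc (trans (length-++ (rep q (x₅ 6))) (cong₂ ℕ._+_ (length-rep q (x₅ 6)) (cong (8 ℕ.+_) (length-rep k x₂)))))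
                (count q k)
    where count : ∀ q k → ℕ.suc (q ℕ.* 6 ℕ.+ (8 ℕ.+ k ℕ.* 6)) ≡ 3 ℕ.+ 6 ℕ.* (ℕ.suc q ℕ.+ k)
          count = ℕ-Solver.solve-∀

  sum-row₁ : sum row₁ ≡ 3 ℕ.* v
  sum-row₁ = trans (cong ℕ.suc (trans (sum-++ (rep q x₄) _) (cong₂ ℕ._+_ (sum-rep q x₄) (cong (2 ℕ.+_) (sum-rep k x₆)))))
                   (count q k)
    where count : ∀ q k → ℕ.suc (q ℕ.* 3 ℕ.+ (2 ℕ.+ k ℕ.* 3)) ≡ 3 ℕ.* (ℕ.suc q ℕ.+ k)
          count = ℕ-Solver.solve-∀

  sum-row₂ : sum row₂ ≡ 3 ℕ.* v ℕ.+ 2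
  sum-row₂ = trans (trans (sum-++ (rep q (x₅ 6)) _) (cong₂ ℕ._+_ (sum-rep q (x₅ 6)) (cong (5 ℕ.+_) (sum-rep k x₂))))
                   (count q k)
    where count : ∀ q k → q ℕ.* 3 ℕ.+ (5 ℕ.+ k ℕ.* 3) ≡ 3 ℕ.* (ℕ.suc q ℕ.+ k) ℕ.+ 2
          count = ℕ-Solver.solve-∀

  g h P Q c T₁ T₂ : ℤ
  g = geometric (z ^ 6) q
  h = geometric (z ^ 6) k
  P = (z ^ 6) ^ q
  Q = (z ^ 6) ^ k
  c = + 1 + z + z * z
  T₁ = - + 2 + (+ 2 + z + z * z + z * z * z * z + z * z * z * z * z) * h + Q * (+ 2 + z + z * z + z * z * z * z)
  T₂ = (+ 1 + + 2 * z + z * z + z * z * z + z * z * z * z * z) * g + P * (+ 1 + + 2 * z + z * z + z * z * z)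

  ev-row₁ : ev z row₁ ≡ + 0 + z * (+ 1 + z * (+ 0 + z * (+ 0 + z * (+ 0 + z * (c * g + P * (+ 1 + z * (+ 1 + z * (+ 0 + z * (+ 0 + z * (z * c * h))))))))))
  ev-row₁ = begin
    ev z row₁
      ≡⟨ cong (λ x → + 0 + z * (+ 1 + z * (+ 0 + z * (+ 0 + z * (+ 0 + z * x))))) (trans (ev-rep-++ z q x₄ _)
           (cong (λ x → ev z x₄ * g + P * (+ 1 + z * (+ 1 + z * (+ 0 + z * (+ 0 + z * x))))) (ev-rep z k x₆))) ⟩
    + 0 + z * (+ 1 + z * (+ 0 + z * (+ 0 + z * (+ 0 + z * (ev z x₄ * g + P * (+ 1 + z * (+ 1 + z * (+ 0 + z * (+ 0 + z * (ev z x₆ * h))))))))))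
      ≡⟨ cong₂ (λ b₄ b₆ → + 0 + z * (+ 1 + z * (+ 0 + z * (+ 0 + z * (+ 0 + z * (b₄ * g + P * (+ 1 + z * (+ 1 + z * (+ 0 + z * (+ 0 + z * (b₆ * h)))))))))))
               (ev-x₄ z) (ev-x₆ z) ⟩
    + 0 + z * (+ 1 + z * (+ 0 + z * (+ 0 + z * (+ 0 + z * (c * g + P * (+ 1 + z * (+ 1 + z * (+ 0 + z * (+ 0 + z * (z * c * h))))))))))
      ∎
    where open ≡-Reasoning

  ev-row₂ : ev z row₂ ≡ + 0 + z * (z * (+ 1 + z * z + z * z * z * z) * g
                         + P * (+ 0 + z * (+ 1 + z * (+ 0 + z * (+ 1 + z * (+ 0 + z * (+ 1 + z * (+ 1 + z * (+ 1 + z * (z * z * z * c * h))))))))))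
  ev-row₂ = begin
    ev z row₂
      ≡⟨ cong (λ x → + 0 + z * x) (trans (ev-rep-++ z q (x₅ 6) _)
           (cong (λ x → ev z (x₅ 6) * g + P * (+ 0 + z * (+ 1 + z * (+ 0 + z * (+ 1 + z * (+ 0 + z * (+ 1 + z * (+ 1 + z * (+ 1 + z * x))))))))) (ev-rep z k x₂))) ⟩
    + 0 + z * (ev z (x₅ 6) * g + P * (+ 0 + z * (+ 1 + z * (+ 0 + z * (+ 1 + z * (+ 0 + z * (+ 1 + z * (+ 1 + z * (+ 1 + z * (ev z x₂ * h))))))))))
      ≡⟨ cong₂ (λ b₅ b₂ → + 0 + z * (b₅ * g + P * (+ 0 + z * (+ 1 + z * (+ 0 + z * (+ 1 + z * (+ 0 + z * (+ 1 + z * (+ 1 + z * (+ 1 + z * (b₂ * h)))))))))))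
               (ev-x₅ z) (ev-x₂ z) ⟩
    + 0 + z * (z * (+ 1 + z * z + z * z * z * z) * g + P * (+ 0 + z * (+ 1 + z * (+ 0 + z * (+ 1 + z * (+ 0 + z * (+ 1 + z * (+ 1 + z * (+ 1 + z * (z * z * z * c * h))))))))))
      ∎
    where open ≡-Reasoning

  z^e≡z⁵Q : z ^ e ≡ z * z * z * z * z * Q
  z^e≡z⁵Q = trans (z^[6q+a] z k 5) (swap Q z)
    where swap : ∀ Q z → Q * (z * (z * (z * (z * (z * + 1))))) ≡ z * z * z * z * z * Q
          swap = solve-∀

  z^m≡z⁹PQ : z ^ m ≡ z * z * z * z * z * z * z * z * z * P * Q
  z^m≡z⁹PQ = begin
    z ^ m                                  ≡⟨ cong (z ^_) (split q k) ⟩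
    z ^ (6 ℕ.* q ℕ.+ (6 ℕ.* k ℕ.+ 9))      ≡⟨ z^[6q+a] z q _ ⟩
    P * z ^ (6 ℕ.* k ℕ.+ 9)                ≡⟨ cong (P *_) (z^[6q+a] z k 9) ⟩
    P * (Q * z ^ 9)                        ≡⟨ regroup z P Q ⟩
    z * z * z * z * z * z * z * z * z * P * Q  ∎
    where open ≡-Reasoning
          split : ∀ q k → 3 ℕ.+ 6 ℕ.* (ℕ.suc q ℕ.+ k) ≡ 6 ℕ.* q ℕ.+ (6 ℕ.* k ℕ.+ 9)
          split = ℕ-Solver.solve-∀
          regroup : ∀ z P Q → P * (Q * (z * (z * (z * (z * (z * (z * (z * (z * (z * + 1)))))))))) ≡ z * z * z * z * z * z * z * z * z * P * Q
          regroup = solve-∀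

  c*t≡z^m : z * z * z * z * P * (z * z * z * z * z * Q) ≡ z ^ m
  c*t≡z^m = trans (regroup z P Q) (sym z^m≡z⁹PQ)
    where regroup : ∀ z P Q → z * z * z * z * P * (z * z * z * z * z * Q) ≡ z * z * z * z * z * z * z * z * z * P * Q
          regroup = solve-∀

  sum-certificate : ∀ z P Q g h →
    let c = + 1 + z + z * z
        ω = z * z * z * z * z * z
        A₁ = + 0 + z * (+ 1 + z * (+ 0 + z * (+ 0 + z * (+ 0 + z * (c * g + P * (+ 1 + z * (+ 1 + z * (+ 0 + z * (+ 0 + z * (z * c * h))))))))))
        A₂ = + 0 + z * (z * (+ 1 + z * z + z * z * z * z) * g
               + P * (+ 0 + z * (+ 1 + z * (+ 0 + z * (+ 1 + z * (+ 0 + z * (+ 1 + z * (+ 1 + z * (+ 1 + z * (z * z * z * c * h))))))))))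
        T₁ = - + 2 + (+ 2 + z + z * z + z * z * z * z + z * z * z * z * z) * h + Q * (+ 2 + z + z * z + z * z * z * z)
        T₂ = (+ 1 + + 2 * z + z * z + z * z * z + z * z * z * z * z) * g + P * (+ 1 + + 2 * z + z * z + z * z * z)
    in A₁ + A₂ ≡ T₁ + z * z * z * z * z * Q * T₂
                 + (+ 2 + z - Q * (+ 2 + z + z * z + z * z * z * z)) * ((ω - + 1) * g - (P - + 1))
                 + P * (+ 2 + z + z * z + z * z * z * z + z * z * z * z * z + + 2 * ω + ω * z + ω * z * z) * ((ω - + 1) * h - (Q - + 1))
                 + (+ 2 + z + z * z + z * z * z * z + z * z * z * z * z) * ((g + P * h) - (h + Q * g))
  sum-certificate = solve-∀

  D-certificate : ∀ z P Q g h →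
    let c = + 1 + z + z * z
        ω = z * z * z * z * z * z
        A₁ = + 0 + z * (+ 1 + z * (+ 0 + z * (+ 0 + z * (+ 0 + z * (c * g + P * (+ 1 + z * (+ 1 + z * (+ 0 + z * (+ 0 + z * (z * c * h))))))))))
        T₁ = - + 2 + (+ 2 + z + z * z + z * z * z * z + z * z * z * z * z) * h + Q * (+ 2 + z + z * z + z * z * z * z)
        T₂ = (+ 1 + + 2 * z + z * z + z * z * z + z * z * z * z * z) * g + P * (+ 1 + + 2 * z + z * z + z * z * z)
    in (+ 1 - z + z * z) * (T₂ + z * z * z * z * P * T₁ - + 2 * A₁) ≡ + 2 * z * z
                 + (- + 1 - z - + 2 * z * z * z) * ((ω - + 1) * g - (P - + 1))
                 + (- (z * z * z * z * P * (+ 2 - z + + 2 * z * z + + 2 * z * z * z * z))) * ((ω - + 1) * h - (Q - + 1))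
                 + (- + 1 + z) * (z * z * z * ω * P * Q - + 1)
  D-certificate = solve-∀

  geometric-relation′ : ∀ j → (z * z * z * z * z * z - + 1) * geometric (z ^ 6) j - ((z ^ 6) ^ j - + 1) ≡ + 0
  geometric-relation′ j = trans (cong (λ ω → (ω - + 1) * geometric (z ^ 6) j - ((z ^ 6) ^ j - + 1)) (sym (z⁶ z)))
                                (geometric-relation (z ^ 6) j)

  caseB : (matSum n r d m (a₁-B m e k) (a₂-B m e k) < 2 ℕ.^ n)
        × (wt (matSum n r d m (a₁-B m e k) (a₂-B m e k)) ≡ (n ℕ.+ 4 ℕ.∸ 3 ℕ.* d) ℕ./ 2)
        × (K r ℕ.* matSum n r d m (a₁-B m e k) (a₂-B m e k) ≡ 1 [mod N ])
  caseB rewrite a₁-B≡row₁ | a₂-B≡row₂ =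
    matSum<2^n ,
    trans wt-matSum (trans (cong₂ (λ a b → d′ ℕ.* a ℕ.+ b) sum-row₁ sum-row₂) (weight-formula d′ v)) ,
    K*matSum≡1 {t = z * z * z * z * z * Q} {c = z * z * z * z * P} {T₁ = T₁} {T₂ = T₂}
      ev-row₁ ev-row₂ z^e≡z⁵Q c*t≡z^m
      (≈-by-certificate (+ 2 + z - Q * (+ 2 + z + z * z + z * z * z * z))
                        (P * (+ 2 + z + z * z + z * z * z * z + z * z * z * z * z + + 2 * ω + ω * z + ω * z * z))
                        (+ 2 + z + z * z + z * z * z * z + z * z * z * z * z)
         (sum-certificate z P Q g h) (≡⇒≈ (geometric-relation′ q)) (≡⇒≈ (geometric-relation′ k))
         (≡⇒≈ (trans (cong₂ _-_ (geometric-swap (z ^ 6) q k) refl) (ℤ.+-inverseʳ (h + Q * g)))))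
      (≈-by-certificate (- + 1 - z - + 2 * z * z * z) (- (z * z * z * z * P * (+ 2 - z + + 2 * z * z + + 2 * z * z * z * z))) (- + 1 + z)
         (D-certificate z P Q g h) (≡⇒≈ (geometric-relation′ q)) (≡⇒≈ (geometric-relation′ k))
         (≈-difference (≈-trans (≡⇒≈ (trans (regroup z P Q) (sym z^m≡z⁹PQ))) z^m≈1)))
    where open Rows row₁ row₂ row₁-bits row₂-bits length-row₁ length-row₂ using (matSum<2^n; wt-matSum; K*matSum≡1)
          open IntegersModulo N
          ω = z * z * z * z * z * z
          regroup : ∀ z P Q → z * z * z * (z * z * z * z * z * z) * P * Q ≡ z * z * z * z * z * z * z * z * z * P * Q
          regroup = solve-∀

module GenericInverse (d′ s v e : Data.Nat.ℕ) (se≡1 : s Data.Nat.* e ≡ 1 [mod 3 Data.Nat.+ 6 Data.Nat.* v ]) where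
  open import Data.Integer using (ℤ; +_; _+_; _-_; _*_; _^_; _%ℕ_)
  import Data.Integer.Properties as ℤ
  open import Data.Integer.DivMod using (n%ℕd<d)
  open import Data.Integer.Tactic.RingSolver using (solve-∀)
  open import Data.Nat as ℕ using (ℕ; s≤s; z≤n)
  import Data.Nat.Properties as ℕ
  import Data.Nat.Tactic.RingSolver as ℕ-Solver
  open import Relation.Binary.PropositionalEquality
  open import Defs using (K)
  open MatrixSum d′ (2 ℕ.+ 6 ℕ.* v) s e se≡1 using (n′; N; r)
  open IntegerCasts using (two; K-cast)
  open PowersOfTwo n′ using (2^n≈1; 2^[n*c]≈1)
  open IntegersModulo N
  open CoefficientLists using (geometric)

  y X₀ : ℤ
  y = two ^ r
  X₀ = two ^ n′ * ((+ 1 + y) * ((y ^ 6) ^ v * (+ 1 + y * y * y * (+ 1 - y * y * y) * geometric (y ^ 6) v)))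

  1<N : 1 ℕ.< N
  1<N = ℕ.<-≤-trans (s≤s (s≤s (z≤n {5}))) (ℕ.∸-monoˡ-≤ 1 (ℕ.^-monoʳ-≤ 2 {3} {ℕ.suc n′} (s≤s (s≤s (s≤s z≤n)))))

  instance
    N≢0 : ℕ.NonZero N
    N≢0 = ℕ.>-nonZero (ℕ.<-trans (s≤s z≤n) 1<N)

  Kinv : ℕ
  Kinv = X₀ %ℕ N

  Kinv<N : Kinv ℕ.< N
  Kinv<N = n%ℕd<d X₀ N

  y-order : (y ^ 6) ^ v * (y * y * y) ≈ + 1
  y-order = begin
    (y ^ 6) ^ v * (y * y * y)      ≡⟨ cong ((y ^ 6) ^ v *_) (cube y) ⟨
    (y ^ 6) ^ v * y ^ 3            ≡⟨ CoefficientLists.z^[6q+a] y v 3 ⟨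
    y ^ (6 ℕ.* v ℕ.+ 3)            ≡⟨ ℤ.^-*-assoc two r (6 ℕ.* v ℕ.+ 3) ⟩
    two ^ (r ℕ.* (6 ℕ.* v ℕ.+ 3))  ≡⟨ cong (two ^_) (exponent d′ s v) ⟩
    two ^ (ℕ.suc n′ ℕ.* s)         ≈⟨ 2^[n*c]≈1 s ⟩
    + 1                            ∎
    where open ≈-Reasoning
          cube : ∀ y → y * (y * (y * + 1)) ≡ y * y * y
          cube = solve-∀
          exponent : ∀ d′ s v → ℕ.suc d′ ℕ.* s ℕ.* (6 ℕ.* v ℕ.+ 3) ≡ ℕ.suc d′ ℕ.* (3 ℕ.+ 6 ℕ.* v) ℕ.* s
          exponent = ℕ-Solver.solve-∀

  K*Kinv≡1 : K r ℕ.* Kinv ≡ 1 [mod N ]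
  K*Kinv≡1 = ≈⇒≡[mod] (begin
    + (K r ℕ.* Kinv)                 ≡⟨ ℤ.pos-* (K r) Kinv ⟩
    + K r * + Kinv                   ≡⟨ cong (_* + Kinv) (K-cast r) ⟩
    (y * y - y + + 1) * + Kinv       ≈⟨ *-cong (≈-refl {y * y - y + + 1}) (%ℕ-≈ X₀) ⟩
    (y * y - y + + 1) * X₀           ≈⟨ OddOrder.K-unit N {two ^ n′} y v y-order 2^n≈1 ⟩
    + 1                              ∎)
    where open ≈-Reasoning

open import Defs
open import Data.Nat using (ℕ; suc; _+_; _*_; _∸_; _^_; _/_; _%_; _<_; _≤_; z≤n; s≤s)
import Data.Nat.Properties as ℕ
open import Data.Nat.GCD using (gcd)
open import Data.Empty using (⊥-elim)
open import Data.Product using (_×_; ∃; _,_)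
open import Relation.Binary.PropositionalEquality
open import Relation.Nullary using (yes; no; ¬_)
open Arithmetic

Conclusion : (n r d v e : ℕ) → Set
Conclusion n r d v e = ∃ λ Kinv →
    (0 < Kinv) × (Kinv ≤ 2 ^ n ∸ 1) × (K r * Kinv ≡ 1 [mod (2 ^ n ∸ 1) ]) ×
    (∀ k → e ≡ 6 * k + 1 →
        (Kinv ≡ matSum n r d (3 + 6 * v) (a₁-A (3 + 6 * v) e k) (a₂-A (3 + 6 * v) e k)
          [mod (2 ^ n ∸ 1) ])
        × (wt Kinv ≡ (n + 4 ∸ 3 * d) / 2)) ×
    (∀ k → e ≡ 6 * k + 5 →
        (Kinv ≡ matSum n r d (3 + 6 * v) (a₁-B (3 + 6 * v) e k) (a₂-B (3 + 6 * v) e k)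
          [mod (2 ^ n ∸ 1) ])
        × (wt Kinv ≡ (n + 4 ∸ 3 * d) / 2))

Conclusion′ : (d′ s v e : ℕ) → Set
Conclusion′ d′ s v e = Conclusion (suc d′ * (3 + 6 * v)) (suc d′ * s) (suc d′) v e

conclusion-A : ∀ d′ p k s → s * (6 * k + 1) ≡ 1 [mod 3 + 6 * (p + k) ] → Conclusion′ d′ s (p + k) (6 * k + 1)
conclusion-A d′ p k s se≡1 with CaseA.caseA d′ p k s se≡1
... | Kinv<2^n , wt≡ , K*Kinv≡1 =
  Kinv , wt-positive wt≡ (weight-positive d′ (p + k)) , <2^n⇒≤2^n∸1 {Kinv} {n} Kinv<2^n , K*Kinv≡1 , same-k , not-B
  where
  m n : ℕ
  m = 3 + 6 * (p + k)
  n = suc d′ * m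
  Kinv = matSum n (suc d′ * s) (suc d′) m (a₁-A m (6 * k + 1) k) (a₂-A m (6 * k + 1) k)
  same-k : ∀ k′ → 6 * k + 1 ≡ 6 * k′ + 1 →
    (Kinv ≡ matSum n (suc d′ * s) (suc d′) m (a₁-A m (6 * k + 1) k′) (a₂-A m (6 * k + 1) k′) [mod (2 ^ n ∸ 1) ])
    × (wt Kinv ≡ (n + 4 ∸ 3 * suc d′) / 2)
  same-k k′ e≡ with 6k+c-injective {k} {k′} 1 e≡
  ... | refl = ≡[mod]-refl (2 ^ n ∸ 1) Kinv , wt≡
  not-B : ∀ k′ → 6 * k + 1 ≡ 6 * k′ + 5 →
    (Kinv ≡ matSum n (suc d′ * s) (suc d′) m (a₁-B m (6 * k + 1) k′) (a₂-B m (6 * k + 1) k′) [mod (2 ^ n ∸ 1) ])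
    × (wt Kinv ≡ (n + 4 ∸ 3 * suc d′) / 2)
  not-B k′ e≡ = ⊥-elim (6k+1≢6k+5 k k′ e≡)

conclusion-B : ∀ d′ q k s → s * (6 * k + 5) ≡ 1 [mod 3 + 6 * (suc q + k) ] → Conclusion′ d′ s (suc q + k) (6 * k + 5)
conclusion-B d′ q k s se≡1 with CaseB.caseB d′ q k s se≡1
... | Kinv<2^n , wt≡ , K*Kinv≡1 =
  Kinv , wt-positive wt≡ (weight-positive d′ (suc q + k)) , <2^n⇒≤2^n∸1 {Kinv} {n} Kinv<2^n , K*Kinv≡1 , not-A , same-k
  where
  m n : ℕ
  m = 3 + 6 * (suc q + k)
  n = suc d′ * m
  Kinv = matSum n (suc d′ * s) (suc d′) m (a₁-B m (6 * k + 5) k) (a₂-B m (6 * k + 5) k)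
  not-A : ∀ k′ → 6 * k + 5 ≡ 6 * k′ + 1 →
    (Kinv ≡ matSum n (suc d′ * s) (suc d′) m (a₁-A m (6 * k + 5) k′) (a₂-A m (6 * k + 5) k′) [mod (2 ^ n ∸ 1) ])
    × (wt Kinv ≡ (n + 4 ∸ 3 * suc d′) / 2)
  not-A k′ e≡ = ⊥-elim (6k+1≢6k+5 k′ k (sym e≡))
  same-k : ∀ k′ → 6 * k + 5 ≡ 6 * k′ + 5 →
    (Kinv ≡ matSum n (suc d′ * s) (suc d′) m (a₁-B m (6 * k + 5) k′) (a₂-B m (6 * k + 5) k′) [mod (2 ^ n ∸ 1) ])
    × (wt Kinv ≡ (n + 4 ∸ 3 * suc d′) / 2)
  same-k k′ e≡ with 6k+c-injective {k} {k′} 5 e≡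
  ... | refl = ≡[mod]-refl (2 ^ n ∸ 1) Kinv , wt≡

conclusion-F : ∀ d′ s v e → s * e ≡ 1 [mod 3 + 6 * v ] → ¬ e % 6 ≡ 1 → ¬ e % 6 ≡ 5 → Conclusion′ d′ s v e
conclusion-F d′ s v e se≡1 ≢1 ≢5 =
  Kinv , inverse-positive {a = K (suc d′ * s)} 1<N K*Kinv≡1 , ℕ.<⇒≤ Kinv<N , K*Kinv≡1 ,
  (λ k e≡ → ⊥-elim (≢1 (trans (cong (_% 6) e≡) ([6k+c]%6 k 1 (s≤s (s≤s z≤n)))))) ,
  (λ k e≡ → ⊥-elim (≢5 (trans (cong (_% 6) e≡) ([6k+c]%6 k 5 ℕ.≤-refl))))
  where open GenericInverse d′ s v e se≡1

conclusion : ∀ d′ s v e → e ≤ 3 + 6 * v → s * e ≡ 1 [mod 3 + 6 * v ] → Conclusion′ d′ s v e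
conclusion d′ s v e e≤m se≡1 with e % 6 ℕ.≟ 1 | e % 6 ℕ.≟ 5
... | yes e%6≡1 | _ with residue-1-split {v} e%6≡1 e≤m
...   | p , k , refl , refl = conclusion-A d′ p k s se≡1
conclusion d′ s v e e≤m se≡1 | no _ | yes e%6≡5 with residue-5-split {v} e%6≡5 e≤m
...   | q , k , refl , refl = conclusion-B d′ q k s se≡1
conclusion d′ s v e e≤m se≡1 | no ≢1 | no ≢5 = conclusion-F d′ s v e se≡1 ≢1 ≢5

proposition6 : (n r d s v e : ℕ) →
  0 < n → 0 < r → gcd r n ≡ d → 1 < d →
  n ≡ d * (3 + 6 * v) → r ≡ d * s →
  0 < e → e ≤ 3 + 6 * v → s * e ≡ 1 [mod (3 + 6 * v) ] →
  ∃ λ Kinv →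
    (0 < Kinv) × (Kinv ≤ 2 ^ n ∸ 1) × (K r * Kinv ≡ 1 [mod (2 ^ n ∸ 1) ]) ×
    (∀ k → e ≡ 6 * k + 1 →
        (Kinv ≡ matSum n r d (3 + 6 * v) (a₁-A (3 + 6 * v) e k) (a₂-A (3 + 6 * v) e k)
          [mod (2 ^ n ∸ 1) ])
        × (wt Kinv ≡ (n + 4 ∸ 3 * d) / 2)) ×
    (∀ k → e ≡ 6 * k + 5 →
        (Kinv ≡ matSum n r d (3 + 6 * v) (a₁-B (3 + 6 * v) e k) (a₂-B (3 + 6 * v) e k)
          [mod (2 ^ n ∸ 1) ])
        × (wt Kinv ≡ (n + 4 ∸ 3 * d) / 2))
proposition6 _ _ (suc d′) s v e _ _ _ (s≤s _) refl refl _ e≤m se≡1 = conclusion d′ s v e e≤m se≡1
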